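{- Let $(\Omega,a)$ be a binding signature with associated endofunctor $\Sigma$ on $\mathcal S$ and let $[\eta_V,\varphi_V]:V+\Sigma(TV)\to TV$ be an initial $(V+\Sigma)$-algebra. Then $\delta(TV)$, with the $\Sigma^\dagger(TV,-)$-algebra structure $\delta(\varphi_V)\circ\mathbf{swap}_{TV}^{ -1}:\Sigma^\dagger(TV,\delta(TV))\to\delta(TV)$ and the morphism $\delta(\eta_V):\delta(V)\to\delta(TV)$, is a free $\Sigma^\dagger(TV,-)$-algebra over $\delta(V)$ (and $\delta(V)\cong J$); that is, $[\delta(\eta_V),\delta(\varphi_V)\circ\mathbf{swap}_{TV}^{ -1}]:\delta(V)+\Sigma^\dagger(TV,\delta(TV))\to\delta(TV)$ is an initial $(\delta(V)+\Sigma^\dagger(TV,-))$-algebra.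
   Context: Let $\mathbb{S}$ be the category whose objects are the sets $\mathbf{n}=\{1,\dots,n\}$ ($n\in\mathbb{N}$) and whose morphisms are surjections; strict monoidal with $\mathbf n\otimes\mathbf m=\mathbf{n+m}$ (elements of $\mathbf m$ after those of $\mathbf n$, morphisms blockwise), unit $\mathbf 0$; $c:\mathbf 2\to\mathbf 1$ the unique map. $\mathcal S=\mathbf{Set}^{\mathbb S}$. Day convolution $(X\hat\otimes Y)(\mathbf n)=\int^{\mathbf m_1,\mathbf m_2}X(\mathbf m_1)\times Y(\mathbf m_2)\times\mathbb S(\mathbf{m_1+m_2},\mathbf n)$, classes $[x,y,f]$, unit $J=\mathbb S(\mathbf 0,-)$; symmetric monoidal closed (distributes over coproducts); associators suppressed. $V=\mathbb S(\mathbf 1,-)$. $\delta:\mathcal S\to\mathcal S$, $\delta(X)(\mathbf n)=X(\mathbf{n+1})$, $\delta(X)(f)=X(f\otimes\mathrm{id}_{\mathbf 1})$; preserves coproducts. $\mathsf{cont}_X:\delta^2X\to\delta X$ has components $X(\mathrm{id}_{\mathbf n}\otimes c)$; $\mathsf{swap}^{(n)}_X:\delta(\delta^nX)\to\delta^n(\delta X)$ has component at $\mathbf m$ equal to $X(\mathrm{id}_{\mathbf m}\otimes\tau_n)$, $\tau_n:\mathbf{1+n}\to\mathbf{n+1}$, $1\mapsto n+1$, $1+i\mapsto i$. Left strength $\mathsf{str}'_{X,Y}:X\hat\otimes\delta Y\to\delta(X\hat\otimes Y)$, $[x,y,f]\mapsto[x,y,f\otimes\mathrm{id}_{\mathbf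 1}]$; right strength $\mathsf{str}_{X,Y}:\delta X\hat\otimes Y\to\delta(X\hat\otimes Y)$, $[x,y,f]\mapsto[x,y,(f\otimes\mathrm{id}_{\mathbf 1})\circ\theta]$ ($x\in X(\mathbf{m_1+1})$, $y\in Y(\mathbf m_2)$), $\theta:\mathbf{m_1+1+m_2}\to\mathbf{m_1+m_2+1}$ fixing $1..m_1$, $m_1+1\mapsto m_1+m_2+1$, $m_1+1+i\mapsto m_1+i$. $\rho_{X,Y}=\mathsf{cont}_{X\hat\otimes Y}\circ\delta(\mathsf{str}'_{X,Y})\circ\mathsf{str}_{X,\delta Y}$. The morphism $[\mathsf{str}_{X,Y},\mathsf{str}'_{X,Y},\rho_{X,Y}]:\delta X\hat\otimes Y+X\hat\otimes\delta Y+\delta X\hat\otimes\delta Y\to\delta(X\hat\otimes Y)$ is an isomorphism with inverse $\mathcal H_{X,Y}$. Let $S(k)=\{0,1\}^k\setminus\{(0,\dots,0)\}$ with projections $\pi_i$; iterating $\mathcal H$ (apply $\mathcal H_{X_1,X_2\hat\otimes\cdots\hat\otimes X_k}$, then $\mathcal H^{k-1}$ on $\delta(X_2\hat\otimes\cdots\hat\otimes X_k)$ in the second and third summands, then distributivity) yields $\mathcal H^k:\delta(X_1\hat\otimes\cdots\hat\otimes X_k)\cong\coprod_{j\in S(k)}\delta^{\pi_1(j)}X_1\hat\otimes\cdots\hat\otimes\delta^{\pi_k(j)}X_k$. A binding signature is a set $\Omega$ with $a:\Omega\to\mathbb N^*$; for $a(\omega)=(n_1,\dots,n_k)$, $\Sigma_\omega(X)=\delta^{n_1}X\hat\otimes\cdots\hat\otimes\delta^{n_k}X$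 ($J$ if $k=0$), $\Sigma=\coprod_\omega\Sigma_\omega$. The relevant derived functor is $\Sigma^\dagger(X,Y)=\coprod_\omega\coprod_{j\in S(k)}\widehat{\bigotimes}_{i=1}^k\delta^{n_i}(\ell(\pi_i(j)))$ with $\ell(0)=X$, $\ell(1)=Y$; $\mathbf{swap}_X:\delta\Sigma X\to\Sigma^\dagger(X,\delta X)$ is the isomorphism given on the $\omega$-summand by $\mathcal H^k$ followed, in summand $j$, by $\mathsf{swap}^{(n_i)}_X$ on each factor with $\pi_i(j)=1$ and the identity on the others. -}

module Defs where

open import Level using (0ℓ)
open import Function using (id)
open import Data.Nat using (ℕ; zero; suc; _+_)
open import Data.Nat.Properties using (+-assoc; +-identityʳ)
open import Data.Fin using (Fin; zero; suc; _↑ˡ_; _↑ʳ_; splitAt; cast)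
open import Data.Fin.Properties
  using (splitAt-↑ˡ; splitAt-↑ʳ; splitAt⁻¹-↑ˡ; splitAt⁻¹-↑ʳ; cast-involutive; join-splitAt)
open import Data.Sum using (_⊎_; inj₁; inj₂; [_,_]′)
import Data.Sum as Sum
import Data.Sum.Relation.Binary.Pointwise as PW
open import Data.Product using (Σ; ∃; _,_; proj₁; proj₂; _×_)
open import Data.List using (List; []; _∷_; length)
open import Data.Vec using (Vec; []; _∷_)
open import Data.Bool using (Bool; true; false; _∨_; T)
open import Data.Unit using (tt)
open import Data.Empty using (⊥-elim)
open import Relation.Nullary using (¬_; yes; no)
open import Relation.Nullary.Decidable using (T?)
open import Relation.Binary using (Setoid; Rel)
open import Relation.Binary.PropositionalEquality as ≡ using (_≡_; refl)
open import Relation.Binary.Construct.Closure.Equivalence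
  using (EqClosure; symmetric) renaming (setoid to eqSetoid)
open import Relation.Binary.Construct.Closure.ReflexiveTransitive using (Star; ε; _◅_; _◅◅_)
open import Relation.Binary.Construct.Closure.Symmetric using (SymClosure; fwd; bwd)

-- The category 𝕊 of finite ordinals 𝐧 = Fin n and surjections

record Surj (m n : ℕ) : Set where
  constructor surjection
  field
    fun  : Fin m → Fin n
    surj : ∀ y → ∃ λ x → fun x ≡ y
open Surj public

_≗S_ : ∀ {m n} → Surj m n → Surj m n → Set
f ≗S g = ∀ z → fun f z ≡ fun g z

idS : ∀ {n} → Surj n n
idS = surjection (λ z → z) (λ y → y , refl)

_∘S_ : ∀ {m n o} → Surj n o → Surj m n → Surj m o
_∘S_ {m} {n} {o} g f = surjection (λ z → fun g (fun f z)) sur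
  where
  sur : ∀ y → ∃ λ x → fun g (fun f x) ≡ y
  sur y with surj g y
  ... | x' , p with surj f x'
  ...   | x , q = x , ≡.trans (≡.cong (fun g) q) p

-- monoidal structure: blockwise action, 𝐧 ⊗ 𝐦 = 𝐧+𝐦 (elements of 𝐦 after those of 𝐧)
⊗fun : ∀ {a b c d} → (Fin a → Fin c) → (Fin b → Fin d) → Fin (a + b) → Fin (c + d)
⊗fun {a} {b} {c} {d} g h z = [ (λ u → g u ↑ˡ d) , (λ v → c ↑ʳ h v) ]′ (splitAt a z)

_⊗S_ : ∀ {a b c d} → Surj a c → Surj b d → Surj (a + b) (c + d)
_⊗S_ {a} {b} {c} {d} g h = surjection (⊗fun (fun g) (fun h)) sur
  where
  sur : ∀ w → ∃ λ x → ⊗fun (fun g) (fun h) x ≡ w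
  sur w with splitAt c w in eq
  ... | inj₁ u with surj g u
  ...   | x , p = x ↑ˡ b ,
          ≡.trans (≡.cong [ (λ u → fun g u ↑ˡ d) , (λ v → c ↑ʳ fun h v) ]′ (splitAt-↑ˡ a x b))
                  (≡.trans (≡.cong (_↑ˡ d) p) (splitAt⁻¹-↑ˡ eq))
  sur w | inj₂ v with surj h v
  ...   | x , p = a ↑ʳ x ,
          ≡.trans (≡.cong [ (λ u → fun g u ↑ˡ d) , (λ v → c ↑ʳ fun h v) ]′ (splitAt-↑ʳ a b x))
                  (≡.trans (≡.cong (c ↑ʳ_) p) (splitAt⁻¹-↑ʳ eq))

-- the bijections 𝐦 ≅ 𝐧 induced by an equation m ≡ n (used to make the
-- associators of ℕ-addition, which the paper suppresses, explicit)
castS : ∀ {m n} → m ≡ n → Surj m n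
castS e = surjection (cast e) (λ y → cast (≡.sym e) y , cast-involutive e (≡.sym e) y)

σfun : ∀ a b → Fin (a + b) → Fin (b + a)
σfun a b z = [ (λ u → b ↑ʳ u) , (λ v → v ↑ˡ a) ]′ (splitAt a z)

σS : ∀ a b → Surj (a + b) (b + a)
σS a b = surjection (σfun a b) sur
  where
  sur : ∀ w → ∃ λ x → σfun a b x ≡ w
  sur w with splitAt b w in eq
  ... | inj₁ v = a ↑ʳ v ,
          ≡.trans (≡.cong [ (λ u → b ↑ʳ u) , (λ v → v ↑ˡ a) ]′ (splitAt-↑ʳ a b v)) (splitAt⁻¹-↑ˡ eq)
  ... | inj₂ u = u ↑ˡ b ,
          ≡.trans (≡.cong [ (λ u → b ↑ʳ u) , (λ v → v ↑ˡ a) ]′ (splitAt-↑ˡ a u b)) (splitAt⁻¹-↑ʳ eq)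

cS : Surj 2 1
cS = surjection (λ _ → zero) (λ { zero → zero , refl })

τS : ∀ n → Surj (1 + n) (n + 1)
τS n = σS 1 n

τ⁻¹S : ∀ n → Surj (n + 1) (1 + n)
τ⁻¹S n = σS n 1

⊗-cong : ∀ {a b c d} {g g' : Surj a c} {h h' : Surj b d} →
         g ≗S g' → h ≗S h' → (g ⊗S h) ≗S (g' ⊗S h')
⊗-cong {a} p q z with splitAt a z
... | inj₁ u = ≡.cong (_↑ˡ _) (p u)
... | inj₂ v = ≡.cong (_ ↑ʳ_) (q v)

⊗-id : ∀ {a b} → (idS {a} ⊗S idS {b}) ≗S idS
⊗-id {a} {b} z = join-splitAt a b z

⊗-∘ : ∀ {a b c d e f'} (g : Surj c e) (g' : Surj d f') (f : Surj a c) (h : Surj b d) →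
      ((g ∘S f) ⊗S (g' ∘S h)) ≗S ((g ⊗S g') ∘S (f ⊗S h))
⊗-∘ {a} {b} {c} {d} g g' f h z with splitAt a z
... | inj₁ u rewrite splitAt-↑ˡ c (fun f u) d = refl
... | inj₂ v rewrite splitAt-↑ʳ c d (fun h v) = refl

-- 𝒮 = Set^𝕊, with Set rendered as setoids (quotients needed for Day convolution)

record Presheaf : Set₁ where
  field
    Ob : ℕ → Setoid 0ℓ 0ℓ
    act : ∀ {m n} → Surj m n → Setoid.Carrier (Ob m) → Setoid.Carrier (Ob n)
    act-cong : ∀ {m n} {f g : Surj m n} {x y : Setoid.Carrier (Ob m)} →
               f ≗S g → Setoid._≈_ (Ob m) x y → Setoid._≈_ (Ob n) (act f x) (act g y)
    act-id : ∀ {n} (x : Setoid.Carrier (Ob n)) → Setoid._≈_ (Ob n) (act idS x) x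
    act-∘ : ∀ {m n o} (g : Surj n o) (f : Surj m n) (x : Setoid.Carrier (Ob m)) →
            Setoid._≈_ (Ob o) (act (g ∘S f) x) (act g (act f x))
open Presheaf public

∣_∣ : Presheaf → ℕ → Set
∣ X ∣ n = Setoid.Carrier (Ob X n)

_⊢_≈_ : (X : Presheaf) {n : ℕ} → ∣ X ∣ n → ∣ X ∣ n → Set
_⊢_≈_ X {n} = Setoid._≈_ (Ob X n)

record Hom (X Y : Presheaf) : Set where
  field
    app : ∀ {n} → ∣ X ∣ n → ∣ Y ∣ n
    app-cong : ∀ {n} {x y : ∣ X ∣ n} → X ⊢ x ≈ y → Y ⊢ app x ≈ app y
    app-nat : ∀ {m n} (f : Surj m n) (x : ∣ X ∣ m) → Y ⊢ app (act X f x) ≈ act Y f (app x)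
open Hom public

record Iso (X Y : Presheaf) : Set where
  field
    to : Hom X Y
    from : Hom Y X
    from∘to : ∀ {n} (x : ∣ X ∣ n) → X ⊢ app from (app to x) ≈ x
    to∘from : ∀ {n} (y : ∣ Y ∣ n) → Y ⊢ app to (app from y) ≈ y

Rep : ℕ → Presheaf
Rep k = record
  { Ob = λ n → record
      { Carrier = Surj k n ; _≈_ = _≗S_
      ; isEquivalence = record
          { refl = λ _ → refl
          ; sym = λ p z → ≡.sym (p z)
          ; trans = λ p q z → ≡.trans (p z) (q z) } }
  ; act = λ h f → h ∘S f
  ; act-cong = λ {_} {_} {h} {h'} {f} {g} p q z → ≡.trans (p (fun f z)) (≡.cong (fun h') (q z))
  ; act-id = λ _ _ → refl
  ; act-∘ = λ _ _ _ _ → refl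
  }

V : Presheaf
V = Rep 1

J : Presheaf
J = Rep 0

δ : Presheaf → Presheaf
δ X = record
  { Ob = λ n → Ob X (n + 1)
  ; act = λ f → act X (f ⊗S idS {1})
  ; act-cong = λ {m} {n} {f} {g} p q →
      act-cong X (⊗-cong {a = m} {b = 1} {c = n} {d = 1} {g = f} {g' = g} {h = idS} {h' = idS} p (λ _ → refl)) q
  ; act-id = λ {n} x → Setoid.trans (Ob X (n + 1)) (act-cong X (⊗-id {n} {1}) (Setoid.refl (Ob X (n + 1)))) (act-id X x)
  ; act-∘ = λ g f x → Setoid.trans (Ob X _)
      (act-cong X (⊗-∘ g idS f idS) (Setoid.refl (Ob X _))) (act-∘ X _ _ x)
  }

δHom : ∀ {X Y} → Hom X Y → Hom (δ X) (δ Y)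
δHom h = record
  { app = app h ; app-cong = app-cong h ; app-nat = λ f x → app-nat h (f ⊗S idS {1}) x }

δ^ : ℕ → Presheaf → Presheaf
δ^ zero X = X
δ^ (suc n) X = δ (δ^ n X)

δ^Hom : ∀ {X Y} (n : ℕ) → Hom X Y → Hom (δ^ n X) (δ^ n Y)
δ^Hom zero h = h
δ^Hom (suc n) h = δHom (δ^Hom n h)

_⊕_ : Presheaf → Presheaf → Presheaf
A ⊕ B = record
  { Ob = λ n → PW.⊎-setoid (Ob A n) (Ob B n)
  ; act = λ f → Sum.map (act A f) (act B f)
  ; act-cong = λ { p (PW.inj₁ q) → PW.inj₁ (act-cong A p q) ; p (PW.inj₂ q) → PW.inj₂ (act-cong B p q) }
  ; act-id = λ { (inj₁ a) → PW.inj₁ (act-id A a) ; (inj₂ b) → PW.inj₂ (act-id B b) }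
  ; act-∘ = λ { g f (inj₁ a) → PW.inj₁ (act-∘ A g f a) ; g f (inj₂ b) → PW.inj₂ (act-∘ B g f b) }
  }

module _ {I : Set} (F : I → Presheaf) where
  data ∐≈ {n : ℕ} : Σ I (λ i → ∣ F i ∣ n) → Σ I (λ i → ∣ F i ∣ n) → Set where
    mk : ∀ {i x y} → F i ⊢ x ≈ y → ∐≈ (i , x) (i , y)

  ∐ : Presheaf
  ∐ = record
    { Ob = λ n → record
        { Carrier = Σ I (λ i → ∣ F i ∣ n) ; _≈_ = ∐≈
        ; isEquivalence = record
            { refl = λ { {i , x} → mk (Setoid.refl (Ob (F i) n)) }
            ; sym = λ { {i , _} (mk p) → mk (Setoid.sym (Ob (F i) n) p) }
            ; trans = λ { {i , _} (mk p) (mk q) → mk (Setoid.trans (Ob (F i) n) p q) } } }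
    ; act = λ f → λ { (i , x) → i , act (F i) f x }
    ; act-cong = λ { p (mk q) → mk (act-cong (F _) p q) }
    ; act-id = λ { (i , x) → mk (act-id (F i) x) }
    ; act-∘ = λ { g f (i , x) → mk (act-∘ (F i) g f x) }
    }

-- Day convolution X ⊗̂ Y as a coend (quotient = equivalence closure)

liftEq : ∀ {A B : Set} {R : Rel A 0ℓ} {R' : Rel B 0ℓ} (F : A → B) →
         (∀ {a b} → R a b → EqClosure R' (F a) (F b)) →
         ∀ {a b} → EqClosure R a b → EqClosure R' (F a) (F b)
liftEq F s ε = ε
liftEq {R' = R'} F s (fwd r ◅ rs) = s r ◅◅ liftEq F s rs
liftEq {R' = R'} F s (bwd r ◅ rs) = symmetric R' (s r) ◅◅ liftEq F s rs

module _ (X Y : Presheaf) where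
  record DayEl (n : ℕ) : Set where
    constructor el
    field
      m₁ m₂ : ℕ
      x : ∣ X ∣ m₁
      y : ∣ Y ∣ m₂
      f : Surj (m₁ + m₂) n

  data DayStep {n : ℕ} : DayEl n → DayEl n → Set where
    cmp : ∀ {m₁ m₂} {x x' : ∣ X ∣ m₁} {y y' : ∣ Y ∣ m₂} {f f' : Surj (m₁ + m₂) n} →
          X ⊢ x ≈ x' → Y ⊢ y ≈ y' → f ≗S f' → DayStep (el m₁ m₂ x y f) (el m₁ m₂ x' y' f')
    coend : ∀ {m₁ m₂ m₁' m₂'} (g₁ : Surj m₁ m₁') (g₂ : Surj m₂ m₂')
            (x : ∣ X ∣ m₁) (y : ∣ Y ∣ m₂) (f : Surj (m₁' + m₂') n) →
            DayStep (el m₁' m₂' (act X g₁ x) (act Y g₂ y) f) (el m₁ m₂ x y (f ∘S (g₁ ⊗S g₂)))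

  private
    dact : ∀ {m n} → Surj m n → DayEl m → DayEl n
    dact h (el m₁ m₂ x y f) = el m₁ m₂ x y (h ∘S f)

    rX : ∀ {m} {x : ∣ X ∣ m} → X ⊢ x ≈ x
    rX {m} = Setoid.refl (Ob X m)
    rY : ∀ {m} {y : ∣ Y ∣ m} → Y ⊢ y ≈ y
    rY {m} = Setoid.refl (Ob Y m)

    one : ∀ {n} {a b : DayEl n} → DayStep a b → EqClosure DayStep a b
    one s = fwd s ◅ ε

    stepLift : ∀ {m n} (h : Surj m n) {a b : DayEl m} → DayStep a b →
               EqClosure DayStep (dact h a) (dact h b)
    stepLift h (cmp p q r) = one (cmp p q (λ z → ≡.cong (fun h) (r z)))
    stepLift h (coend g₁ g₂ x y f) =
      fwd (coend g₁ g₂ x y (h ∘S f)) ◅ fwd (cmp rX rY (λ _ → refl)) ◅ ε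

    dcong : ∀ {m n} {h h' : Surj m n} {a b : DayEl m} → h ≗S h' →
            EqClosure DayStep a b → EqClosure DayStep (dact h a) (dact h' b)
    dcong {h = h} {h'} {b = el m₁ m₂ x y f} p e =
      liftEq (dact h) (stepLift h) e ◅◅ one (cmp rX rY (λ z → p (fun f z)))

  infixr 6 _⊗̂_
  _⊗̂_ : Presheaf
  _⊗̂_ = record
    { Ob = λ n → eqSetoid (DayStep {n})
    ; act = dact
    ; act-cong = dcong
    ; act-id = λ { (el _ _ x y f) → one (cmp rX rY (λ _ → refl)) }
    ; act-∘ = λ { g f (el _ _ x y k) → one (cmp rX rY (λ _ → refl)) }
    }


⊗map : ∀ {A A' B B'} → (∀ {m} → ∣ A ∣ m → ∣ A' ∣ m) → (∀ {m} → ∣ B ∣ m → ∣ B' ∣ m) →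
       ∀ {n} → ∣ A ⊗̂ B ∣ n → ∣ A' ⊗̂ B' ∣ n
⊗map α β (el m₁ m₂ x y f) = el m₁ m₂ (α x) (β y) f

θS : ∀ m₁ m₂ → Surj ((m₁ + 1) + m₂) ((m₁ + m₂) + 1)
θS m₁ m₂ = castS (≡.sym (+-assoc m₁ m₂ 1)) ∘S ((idS {m₁} ⊗S σS 1 m₂) ∘S castS (+-assoc m₁ 1 m₂))

str : ∀ {X Y n} → ∣ δ X ⊗̂ Y ∣ n → ∣ δ (X ⊗̂ Y) ∣ n
str (el m₁ m₂ x y f) = el (m₁ + 1) m₂ x y ((f ⊗S idS {1}) ∘S θS m₁ m₂)

str' : ∀ {X Y n} → ∣ X ⊗̂ δ Y ∣ n → ∣ δ (X ⊗̂ Y) ∣ n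
str' (el m₁ m₂ x y f) = el m₁ (m₂ + 1) x y ((f ⊗S idS {1}) ∘S castS (≡.sym (+-assoc m₁ m₂ 1)))

contS : ∀ n → Surj ((n + 1) + 1) (n + 1)
contS n = (idS {n} ⊗S cS) ∘S castS (+-assoc n 1 1)

cont : ∀ X {n} → ∣ δ (δ X) ∣ n → ∣ δ X ∣ n
cont X {n} = act X (contS n)

ρ : ∀ {X Y n} → ∣ δ X ⊗̂ δ Y ∣ n → ∣ δ (X ⊗̂ Y) ∣ n
ρ {X} {Y} e = cont (X ⊗̂ Y) (str' {X} {Y} (str {X} {δ Y} e))

-- δⁿX(𝐦) = X(𝐦+𝟏+⋯+𝟏)
sh : ℕ → ℕ → ℕ
sh m zero = m
sh m (suc n) = sh (m + 1) n

sh≡ : ∀ m n → sh m n ≡ m + n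
sh≡ m zero = ≡.sym (+-identityʳ m)
sh≡ m (suc n) = ≡.trans (sh≡ (m + 1) n) (+-assoc m 1 n)

get : ∀ X n {m} → ∣ δ^ n X ∣ m → ∣ X ∣ (sh m n)
get X zero x = x
get X (suc n) {m} x = get X n {m + 1} x

put : ∀ X n {m} → ∣ X ∣ (sh m n) → ∣ δ^ n X ∣ m
put X zero x = x
put X (suc n) {m} x = put X n {m + 1} x

private
  e₁ : ∀ m n → sh (m + 1) n ≡ m + (1 + n)
  e₁ m n = ≡.trans (sh≡ (m + 1) n) (+-assoc m 1 n)
  e₂ : ∀ m n → m + (n + 1) ≡ sh m n + 1
  e₂ m n = ≡.trans (≡.sym (+-assoc m n 1)) (≡.cong (_+ 1) (≡.sym (sh≡ m n)))

swapS : ∀ m n → Surj (sh (m + 1) n) (sh m n + 1)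
swapS m n = castS (e₂ m n) ∘S ((idS {m} ⊗S τS n) ∘S castS (e₁ m n))

swap⁻¹S : ∀ m n → Surj (sh m n + 1) (sh (m + 1) n)
swap⁻¹S m n = castS (≡.sym (e₁ m n)) ∘S ((idS {m} ⊗S τ⁻¹S n) ∘S castS (≡.sym (e₂ m n)))

swapⁿ : ∀ X n {m} → ∣ δ (δ^ n X) ∣ m → ∣ δ^ n (δ X) ∣ m
swapⁿ X n {m} x = put (δ X) n {m} (act X (swapS m n) (get X n {m + 1} x))

swapⁿ⁻¹ : ∀ X n {m} → ∣ δ^ n (δ X) ∣ m → ∣ δ (δ^ n X) ∣ m
swapⁿ⁻¹ X n {m} x = put X n {m + 1} (act X (swap⁻¹S m n) (get (δ X) n {m} x))

record Signature : Set₁ where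
  field
    Op : Set
    ar : Op → List ℕ
open Signature public

TL : List ℕ → Presheaf → Presheaf
TL [] X = J
TL (n ∷ []) X = δ^ n X
TL (n ∷ n' ∷ ns) X = δ^ n X ⊗̂ TL (n' ∷ ns) X

-- ℓ(0) = X, ℓ(1) = Y  (false ↔ 0, true ↔ 1)
ℓ : Bool → Presheaf → Presheaf → Presheaf
ℓ false X Y = X
ℓ true X Y = Y

TF : (ns : List ℕ) → Vec Bool (length ns) → Presheaf → Presheaf → Presheaf
TF [] [] X Y = J
TF (n ∷ []) (b ∷ []) X Y = δ^ n (ℓ b X Y)
TF (n ∷ n' ∷ ns) (b ∷ bs) X Y = δ^ n (ℓ b X Y) ⊗̂ TF (n' ∷ ns) bs X Y

-- S(k) = {0,1}ᵏ ∖ {(0,…,0)}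
nz : ∀ {k} → Vec Bool k → Bool
nz [] = false
nz (b ∷ bs) = b ∨ nz bs

S : ℕ → Set
S k = Σ (Vec Bool k) (λ j → T (nz j))

SigF : Signature → Presheaf → Presheaf
SigF sig X = ∐ (λ ω → TL (ar sig ω) X)

SigD : Signature → Presheaf → Presheaf → Presheaf
SigD sig X Y = ∐ (λ ω → ∐ (λ (j : S (length (ar sig ω))) → TF (ar sig ω) (proj₁ j) X Y))

TLmap : ∀ (ns : List ℕ) {A B} → Hom A B → ∀ {m} → ∣ TL ns A ∣ m → ∣ TL ns B ∣ m
TLmap [] h x = x
TLmap (n ∷ []) h x = app (δ^Hom n h) x
TLmap (n ∷ n' ∷ ns) h x = ⊗map (app (δ^Hom n h)) (TLmap (n' ∷ ns) h) x

ℓmap : ∀ (b : Bool) n {X A B} → Hom A B → ∀ {m} → ∣ δ^ n (ℓ b X A) ∣ m → ∣ δ^ n (ℓ b X B) ∣ m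
ℓmap false n h x = x
ℓmap true n h x = app (δ^Hom n h) x

TFmap : ∀ (ns : List ℕ) (bs : Vec Bool (length ns)) {X A B} → Hom A B →
        ∀ {m} → ∣ TF ns bs X A ∣ m → ∣ TF ns bs X B ∣ m
TFmap [] [] h x = x
TFmap (n ∷ []) (b ∷ []) h x = ℓmap b n h x
TFmap (n ∷ n' ∷ ns) (b ∷ bs) h x = ⊗map (ℓmap b n h) (TFmap (n' ∷ ns) bs h) x

Σmap : ∀ sig {A B} → Hom A B → ∀ {m} → ∣ SigF sig A ∣ m → ∣ SigF sig B ∣ m
Σmap sig h (ω , t) = ω , TLmap (ar sig ω) h t

Σ†map : ∀ sig X {A B} → Hom A B → ∀ {m} → ∣ SigD sig X A ∣ m → ∣ SigD sig X B ∣ m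
Σ†map sig X h (ω , j , t) = ω , j , TFmap (ar sig ω) (proj₁ j) h t

-- swap⁻¹ : Σ†(X, δX) → δ(ΣX), i.e. inverse swaps on the factors with
-- πᵢ(j) = 1 followed by the inverse of 𝓗ᵏ (built from str, str', ρ)

allX : ∀ (ns : List ℕ) (bs : Vec Bool (length ns)) {X Y} → ¬ T (nz bs) →
       ∀ {m} → ∣ TF ns bs X Y ∣ m → ∣ TL ns X ∣ m
allX [] [] q x = x
allX (n ∷ []) (false ∷ []) q x = x
allX (n ∷ []) (true ∷ []) q x = ⊥-elim (q tt)
allX (n ∷ n' ∷ ns) (false ∷ bs) q (el m₁ m₂ x y f) = el m₁ m₂ x (allX (n' ∷ ns) bs q y) f
allX (n ∷ n' ∷ ns) (true ∷ bs) q x = ⊥-elim (q tt)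

unswap : ∀ (ns : List ℕ) (bs : Vec Bool (length ns)) X → T (nz bs) →
         ∀ {m} → ∣ TF ns bs X (δ X) ∣ m → ∣ δ (TL ns X) ∣ m
unswap [] [] X ()
unswap (n ∷ []) (true ∷ []) X p x = swapⁿ⁻¹ X n x
unswap (n ∷ []) (false ∷ []) X ()
unswap (n ∷ n' ∷ ns) (true ∷ bs) X p (el m₁ m₂ x y f) with T? (nz bs)
... | yes q = ρ {δ^ n X} {TL (n' ∷ ns) X} (el m₁ m₂ (swapⁿ⁻¹ X n x) (unswap (n' ∷ ns) bs X q y) f)
... | no q = str {δ^ n X} {TL (n' ∷ ns) X} (el m₁ m₂ (swapⁿ⁻¹ X n x) (allX (n' ∷ ns) bs q y) f)
unswap (n ∷ n' ∷ ns) (false ∷ bs) X p (el m₁ m₂ x y f) =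
  str' {δ^ n X} {TL (n' ∷ ns) X} (el m₁ m₂ x (unswap (n' ∷ ns) bs X p y) f)

swap⁻¹ : ∀ sig X {n} → ∣ SigD sig X (δ X) ∣ n → ∣ δ (SigF sig X) ∣ n
swap⁻¹ sig X (ω , (bs , p) , t) = ω , unswap (ar sig ω) bs X p t

record Endo : Set₁ where
  field
    F₀ : Presheaf → Presheaf
    F₁ : ∀ {A B} → Hom A B → ∀ {n} → ∣ F₀ A ∣ n → ∣ F₀ B ∣ n
open Endo public

IsAlgHom : (F : Endo) (C : Presheaf) (c : ∀ {n} → ∣ F₀ F C ∣ n → ∣ C ∣ n)
           (A : Presheaf) (a : Hom (F₀ F A) A) → Hom C A → Set
IsAlgHom F C c A a h = ∀ {n} (x : ∣ F₀ F C ∣ n) → A ⊢ app h (c x) ≈ app a (F₁ F h x)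

IsInitial : (F : Endo) (C : Presheaf) (c : ∀ {n} → ∣ F₀ F C ∣ n → ∣ C ∣ n) → Set₁
IsInitial F C c =
  ∀ (A : Presheaf) (a : Hom (F₀ F A) A) →
    Σ (Hom C A) (IsAlgHom F C c A a) ×
    (∀ (h h' : Hom C A) → IsAlgHom F C c A a h → IsAlgHom F C c A a h' →
       ∀ {n} (x : ∣ C ∣ n) → A ⊢ app h x ≈ app h' x)

VΣ : Signature → Endo
VΣ sig = record { F₀ = λ A → V ⊕ SigF sig A ; F₁ = λ h → Sum.map id (Σmap sig h) }

δVΣ† : Signature → Presheaf → Endo
δVΣ† sig X = record { F₀ = λ B → δ V ⊕ SigD sig X B ; F₁ = λ h → Sum.map id (Σ†map sig X h) }

algStr : ∀ sig (TV : Presheaf) → Hom V TV → Hom (SigF sig TV) TV →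
         ∀ {n} → ∣ V ⊕ SigF sig TV ∣ n → ∣ TV ∣ n
algStr sig TV η φ (inj₁ v) = app η v
algStr sig TV η φ (inj₂ t) = app φ t

derivStr : ∀ sig (TV : Presheaf) → Hom V TV → Hom (SigF sig TV) TV →
           ∀ {n} → ∣ δ V ⊕ SigD sig TV (δ TV) ∣ n → ∣ δ TV ∣ n
derivStr sig TV η φ (inj₁ v) = app (δHom η) v
derivStr sig TV η φ (inj₂ t) = app (δHom φ) (swap⁻¹ sig TV t)

{-# OPTIONS --safe #-}
module Submission where

-- The heart of the proof is that swap : δ(ΣX) → Σ†(X, δX) is a natural isomorphism. It comes
-- from the Leibniz rule δ(A ⊗̂ B) ≅ δA ⊗̂ B + A ⊗̂ δB + δA ⊗̂ δB: a representative [x, y, f] of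
-- δ(A ⊗̂ B), with f onto 𝐧+𝟏, is put in normal form by factoring each half of f through the
-- finest quotient that keeps the old points apart and collapses those sent to the fresh point.
-- Universality of this factorisation makes the normal form respect the coend relation.
--
-- Initiality of δ(TV) then follows from initiality of TV. The functor δ has a right adjoint Ran
-- (right Kan extension along − + 1). Given a δV + Σ†(TV, −)-algebra A, we make TV × Ran A a
-- V + Σ-algebra using η, φ, swap and the structure of A. The fold TV → TV × Ran A is the identity
-- on the first component, and the transpose of its second component is the algebra morphism
-- δ(TV) → A. For uniqueness, the transpose of any algebra morphism, paired with the identity,
-- is again a morphism of V + Σ-algebras into TV × Ran A, so it equals the fold. Finally δV ≅ J,
-- because a one-point set surjects only onto 𝟏.

open import Defs
open import Data.Nat using (ℕ; zero; suc; _+_)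
open import Data.Nat.Properties using (+-assoc)
open import Data.Fin using (Fin; zero; suc; _↑ˡ_; _↑ʳ_; splitAt; cast; toℕ)
open import Data.Fin.Properties
  using ( splitAt-↑ˡ; splitAt-↑ʳ; splitAt⁻¹-↑ˡ; splitAt⁻¹-↑ʳ; toℕ-injective; toℕ-cast; toℕ-↑ˡ; toℕ-↑ʳ
        ; ↑ˡ-injective; cast-involutive; cast-trans; any?)
open import Data.Bool using (Bool; true; false; T; _∨_)
open import Data.Bool.Properties using (¬-not; T-irrelevant) renaming (_≟_ to _≟ᵇ_)
open import Data.Unit using (tt)
open import Data.Empty using (⊥; ⊥-elim)
open import Data.Product using (∃; _×_; _,_; proj₁; proj₂)
open import Data.Sum using (_⊎_; inj₁; inj₂; [_,_]′)
import Data.Sum.Relation.Binary.Pointwise as PW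
open import Data.List using (List; []; _∷_; length)
open import Data.Vec using (Vec; []; _∷_; lookup; tabulate)
open import Data.Vec.Properties using (lookup∘tabulate)
open import Relation.Nullary using (¬_; yes; no)
open import Relation.Nullary.Decidable using (T?)
open import Relation.Binary using (Setoid; IsEquivalence)
open import Relation.Binary.PropositionalEquality using (_≡_; _≢_; refl; sym; trans; cong; subst)
import Relation.Binary.Reasoning.Setoid as ≈-Reasoning
open import Relation.Binary.Construct.Closure.Equivalence using (gfold)
open import Relation.Binary.Construct.Closure.ReflexiveTransitive using (ε; _◅_)
open import Relation.Binary.Construct.Closure.Symmetric using (fwd)


-- Presheaves, natural transformations and Day convolution

module Fibre (A : Presheaf) {n : ℕ} = Setoid (Ob A n)

≡⇒≈ : ∀ A {n} {x y : ∣ A ∣ n} → x ≡ y → A ⊢ x ≈ y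
≡⇒≈ A refl = Fibre.refl A

idH : ∀ {A} → Hom A A
idH {A} = record { app = λ x → x ; app-cong = λ p → p ; app-nat = λ f x → Fibre.refl A }

infixr 9 _∘H_
_∘H_ : ∀ {A B C} → Hom B C → Hom A B → Hom A C
_∘H_ {C = C} h k = record
  { app = λ x → app h (app k x)
  ; app-cong = λ p → app-cong h (app-cong k p)
  ; app-nat = λ f x → Fibre.trans C (app-cong h (app-nat k f x)) (app-nat h f (app k x)) }

infix 4 _≈H_
_≈H_ : ∀ {A B} → Hom A B → Hom A B → Set
_≈H_ {A} {B} h k = ∀ {n} (x : ∣ A ∣ n) → B ⊢ app h x ≈ app k x

δ^Hom-cong : ∀ n {A B} {h k : Hom A B} → h ≈H k → δ^Hom n h ≈H δ^Hom n k
δ^Hom-cong zero e = e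
δ^Hom-cong (suc n) e = δ^Hom-cong n e

δ^Hom-id : ∀ n {A m} (x : ∣ δ^ n A ∣ m) → app (δ^Hom n (idH {A})) x ≡ x
δ^Hom-id zero x = refl
δ^Hom-id (suc n) x = δ^Hom-id n x

δ^Hom-∘ : ∀ n {A B C} (h : Hom B C) (k : Hom A B) {m} (x : ∣ δ^ n A ∣ m) →
          app (δ^Hom n h) (app (δ^Hom n k) x) ≡ app (δ^Hom n (h ∘H k)) x
δ^Hom-∘ zero h k x = refl
δ^Hom-∘ (suc n) h k x = δ^Hom-∘ n h k x

inj₁H : ∀ {A B} → Hom A (A ⊕ B)
inj₁H {A} = record { app = inj₁ ; app-cong = PW.inj₁ ; app-nat = λ f x → PW.inj₁ (Fibre.refl A) }

inj₂H : ∀ {A B} → Hom B (A ⊕ B)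
inj₂H {B = B} = record { app = inj₂ ; app-cong = PW.inj₂ ; app-nat = λ f x → PW.inj₂ (Fibre.refl B) }

module _ {A B : Presheaf} {n : ℕ} where

  day-step : ∀ {e e' : DayEl A B n} → DayStep A B e e' → (A ⊗̂ B) ⊢ e ≈ e'
  day-step s = fwd s ◅ ε

  day-cmp : ∀ {m₁ m₂} {x x' : ∣ A ∣ m₁} {y y' : ∣ B ∣ m₂} {f f' : Surj (m₁ + m₂) n} →
            A ⊢ x ≈ x' → B ⊢ y ≈ y' → f ≗S f' → (A ⊗̂ B) ⊢ el m₁ m₂ x y f ≈ el m₁ m₂ x' y' f'
  day-cmp p q r = day-step (cmp p q r)

  day-≗ : ∀ {m₁ m₂} {x : ∣ A ∣ m₁} {y : ∣ B ∣ m₂} {f f' : Surj (m₁ + m₂) n} →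
          f ≗S f' → (A ⊗̂ B) ⊢ el m₁ m₂ x y f ≈ el m₁ m₂ x y f'
  day-≗ = day-cmp (Fibre.refl A) (Fibre.refl B)

⊗map-cong : ∀ {A A' B B'} (α : ∀ {m} → ∣ A ∣ m → ∣ A' ∣ m) (β : ∀ {m} → ∣ B ∣ m → ∣ B' ∣ m) →
            (∀ {m} {x y : ∣ A ∣ m} → A ⊢ x ≈ y → A' ⊢ α x ≈ α y) →
            (∀ {m} {x y : ∣ B ∣ m} → B ⊢ x ≈ y → B' ⊢ β x ≈ β y) →
            (∀ {m m'} (g : Surj m m') x → A' ⊢ α (act A g x) ≈ act A' g (α x)) →
            (∀ {m m'} (g : Surj m m') y → B' ⊢ β (act B g y) ≈ act B' g (β y)) →
            ∀ {n} {d d' : DayEl A B n} → (A ⊗̂ B) ⊢ d ≈ d' → (A' ⊗̂ B') ⊢ ⊗map α β d ≈ ⊗map α β d'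
⊗map-cong {A} {A'} {B} {B'} α β α-cong β-cong α-nat β-nat =
  gfold (Setoid.isEquivalence (Ob (A' ⊗̂ B') _)) (⊗map α β) respects-step
  where
  respects-step : ∀ {n} {d d' : DayEl A B n} → DayStep A B d d' → (A' ⊗̂ B') ⊢ ⊗map α β d ≈ ⊗map α β d'
  respects-step (cmp p q r) = day-cmp (α-cong p) (β-cong q) r
  respects-step (coend g₁ g₂ x y f) =
    Fibre.trans (A' ⊗̂ B') (day-cmp (α-nat g₁ x) (β-nat g₂ y) (λ _ → refl)) (day-step (coend g₁ g₂ (α x) (β y) f))

-- Finite ordinals and the fresh point of 𝐧+𝟏

id : ∀ {a} → Fin a → Fin a
id w = w

data SplitView (a b : ℕ) : Fin (a + b) → Set where
  left  : (u : Fin a) → SplitView a b (u ↑ˡ b)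
  right : (v : Fin b) → SplitView a b (a ↑ʳ v)

splitView : ∀ a b (w : Fin (a + b)) → SplitView a b w
splitView a b w with splitAt a w in eq
... | inj₁ u = subst (SplitView a b) (splitAt⁻¹-↑ˡ eq) (left u)
... | inj₂ v = subst (SplitView a b) (splitAt⁻¹-↑ʳ eq) (right v)

module _ {a b c d : ℕ} (g : Fin a → Fin c) (h : Fin b → Fin d) where

  ⊗fun-↑ˡ : ∀ u → ⊗fun g h (u ↑ˡ b) ≡ g u ↑ˡ d
  ⊗fun-↑ˡ u rewrite splitAt-↑ˡ a u b = refl

  ⊗fun-↑ʳ : ∀ v → ⊗fun g h (a ↑ʳ v) ≡ c ↑ʳ h v
  ⊗fun-↑ʳ v rewrite splitAt-↑ʳ a b v = refl

σfun-↑ˡ : ∀ a b (u : Fin a) → σfun a b (u ↑ˡ b) ≡ b ↑ʳ u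
σfun-↑ˡ a b u rewrite splitAt-↑ˡ a u b = refl

σfun-↑ʳ : ∀ a b (v : Fin b) → σfun a b (a ↑ʳ v) ≡ v ↑ˡ a
σfun-↑ʳ a b v rewrite splitAt-↑ʳ a b v = refl

cast-≡ : ∀ {m n} .(e : m ≡ n) {i : Fin m} {j : Fin n} → toℕ i ≡ toℕ j → cast e i ≡ j
cast-≡ e {i} p = toℕ-injective (trans (toℕ-cast e i) p)

cast-flip : ∀ {m n} .(e : m ≡ n) .(e' : n ≡ m) {i : Fin m} {j : Fin n} → cast e i ≡ j → cast e' j ≡ i
cast-flip e e' {i} p = cast-≡ e' (trans (cong toℕ (sym p)) (toℕ-cast e i))

module _ {a b c : ℕ} where

  ↑ˡ↑ˡ-assocʳ : .(e : (a + b) + c ≡ a + (b + c)) (u : Fin a) → cast e ((u ↑ˡ b) ↑ˡ c) ≡ u ↑ˡ (b + c)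
  ↑ˡ↑ˡ-assocʳ e u = cast-≡ e (trans (toℕ-↑ˡ (u ↑ˡ b) c) (trans (toℕ-↑ˡ u b) (sym (toℕ-↑ˡ u (b + c)))))

  ↑ʳ↑ˡ-assocʳ : .(e : (a + b) + c ≡ a + (b + c)) (v : Fin b) → cast e ((a ↑ʳ v) ↑ˡ c) ≡ a ↑ʳ (v ↑ˡ c)
  ↑ʳ↑ˡ-assocʳ e v = cast-≡ e (trans (toℕ-↑ˡ (a ↑ʳ v) c) (trans (toℕ-↑ʳ a v)
    (trans (cong (a +_) (sym (toℕ-↑ˡ v c))) (sym (toℕ-↑ʳ a (v ↑ˡ c))))))

  ↑ʳ↑ʳ-assocʳ : .(e : (a + b) + c ≡ a + (b + c)) (w : Fin c) → cast e ((a + b) ↑ʳ w) ≡ a ↑ʳ (b ↑ʳ w)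
  ↑ʳ↑ʳ-assocʳ e w = cast-≡ e (trans (toℕ-↑ʳ (a + b) w) (trans (+-assoc a b (toℕ w))
    (trans (cong (a +_) (sym (toℕ-↑ʳ b w))) (sym (toℕ-↑ʳ a (b ↑ʳ w))))))

  ↑ˡ↑ˡ-assocˡ : .(e : a + (b + c) ≡ (a + b) + c) (u : Fin a) → cast e (u ↑ˡ (b + c)) ≡ (u ↑ˡ b) ↑ˡ c
  ↑ˡ↑ˡ-assocˡ e u = cast-flip (sym e) e (↑ˡ↑ˡ-assocʳ (sym e) u)

  ↑ʳ↑ˡ-assocˡ : .(e : a + (b + c) ≡ (a + b) + c) (v : Fin b) → cast e (a ↑ʳ (v ↑ˡ c)) ≡ (a ↑ʳ v) ↑ˡ c
  ↑ʳ↑ˡ-assocˡ e v = cast-flip (sym e) e (↑ʳ↑ˡ-assocʳ (sym e) v)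

  ↑ʳ↑ʳ-assocˡ : .(e : a + (b + c) ≡ (a + b) + c) (w : Fin c) → cast e (a ↑ʳ (b ↑ʳ w)) ≡ (a + b) ↑ʳ w
  ↑ʳ↑ʳ-assocˡ e w = cast-flip (sym e) e (↑ʳ↑ʳ-assocʳ (sym e) w)

fresh : ∀ n → Fin (n + 1)
fresh n = n ↑ʳ zero

data FreshView (n : ℕ) : Fin (n + 1) → Set where
  old : (i : Fin n) → FreshView n (i ↑ˡ 1)
  new : FreshView n (fresh n)

freshView : ∀ n (w : Fin (n + 1)) → FreshView n w
freshView n w with splitView n 1 w
... | left i = old i
... | right zero = new

old-or-fresh : ∀ {n} (w : Fin (n + 1)) → (∃ λ i → w ≡ i ↑ˡ 1) ⊎ (w ≡ fresh n)
old-or-fresh {n} w with freshView n w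
... | old i = inj₁ (i , refl)
... | new = inj₂ refl

old≢fresh : ∀ {n} (i : Fin n) → i ↑ˡ 1 ≢ fresh n
old≢fresh {n} i e with trans (sym (splitAt-↑ˡ n i 1)) (trans (cong (splitAt n) e) (splitAt-↑ʳ n 1 zero))
... | ()

isOld : ∀ {n} → Fin (n + 1) → Bool
isOld {n} w = [ (λ _ → true) , (λ _ → false) ]′ (splitAt n w)

isOld-old : ∀ {n} (i : Fin n) → isOld (i ↑ˡ 1) ≡ true
isOld-old {n} i rewrite splitAt-↑ˡ n i 1 = refl

isOld-fresh : ∀ n → isOld (fresh n) ≡ false
isOld-fresh n rewrite splitAt-↑ʳ n 1 zero = refl

isOld-true : ∀ {n} (w : Fin (n + 1)) → isOld w ≡ true → ∃ λ i → w ≡ i ↑ˡ 1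
isOld-true {n} w p with freshView n w
... | old i = i , refl
... | new with () ← trans (sym p) (isOld-fresh n)

isOld-false : ∀ {n} (w : Fin (n + 1)) → isOld w ≡ false → w ≡ fresh n
isOld-false {n} w p with freshView n w
... | new = refl
... | old i with () ← trans (sym p) (isOld-old i)

old⇒≢fresh : ∀ {n} {w : Fin (n + 1)} → isOld w ≡ true → w ≢ fresh n
old⇒≢fresh {n} p refl with () ← trans (sym p) (isOld-fresh n)

count : ∀ {m} → Vec Bool m → ℕ
count [] = zero
count (true ∷ v) = suc (count v)
count (false ∷ v) = count v

enum : ∀ {m} (v : Vec Bool m) → Fin (count v) → Fin m
enum (true ∷ v) zero = zero
enum (true ∷ v) (suc j) = suc (enum v j)
enum (false ∷ v) j = suc (enum v j)

rank : ∀ {m} (v : Vec Bool m) (z : Fin m) → .(lookup v z ≡ true) → Fin (count v)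
rank (true ∷ v) zero p = zero
rank (true ∷ v) (suc z) p = suc (rank v z p)
rank (false ∷ v) (suc z) p = rank v z p

enum-true : ∀ {m} (v : Vec Bool m) j → lookup v (enum v j) ≡ true
enum-true (true ∷ v) zero = refl
enum-true (true ∷ v) (suc j) = enum-true v j
enum-true (false ∷ v) j = enum-true v j

enum-rank : ∀ {m} (v : Vec Bool m) z .(p : lookup v z ≡ true) → enum v (rank v z p) ≡ z
enum-rank (true ∷ v) zero p = refl
enum-rank (true ∷ v) (suc z) p = cong suc (enum-rank v z p)
enum-rank (false ∷ v) (suc z) p = cong suc (enum-rank v z p)

rank-enum : ∀ {m} (v : Vec Bool m) j .(p : lookup v (enum v j) ≡ true) → rank v (enum v j) p ≡ j
rank-enum (true ∷ v) zero p = refl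
rank-enum (true ∷ v) (suc j) p = cong suc (rank-enum v j p)
rank-enum (false ∷ v) j p = rank-enum v j p

-- Factorising a map onto 𝐧+𝟏

shᵇ : Bool → ℕ → ℕ
shᵇ true k = k + 1
shᵇ false k = k

embedᵇ : ∀ b {k n} → (Fin k → Fin n) → Fin (shᵇ b k) → Fin (n + 1)
embedᵇ true e = ⊗fun e id
embedᵇ false e w = e w ↑ˡ 1

mapᵇ : ∀ b {k k'} → (Fin k → Fin k') → Fin (shᵇ b k) → Fin (shᵇ b k')
mapᵇ true c = ⊗fun c id
mapᵇ false c = c

module _ {k n : ℕ} (e : Fin k → Fin n) where

  embed-old : ∀ j → embedᵇ true e (j ↑ˡ 1) ≡ e j ↑ˡ 1
  embed-old = ⊗fun-↑ˡ e id

  embed-fresh : embedᵇ true e (fresh k) ≡ fresh n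
  embed-fresh = ⊗fun-↑ʳ e id zero

  embedᵇ-cong : ∀ b {e' : Fin k → Fin n} → (∀ j → e j ≡ e' j) → ∀ w → embedᵇ b e w ≡ embedᵇ b e' w
  embedᵇ-cong true {e'} p w with freshView k w
  ... | old j = trans (embed-old j) (trans (cong (_↑ˡ 1) (p j)) (sym (⊗fun-↑ˡ e' id j)))
  ... | new = trans embed-fresh (sym (⊗fun-↑ʳ e' id zero))
  embedᵇ-cong false p w = cong (_↑ˡ 1) (p w)

  embedᵇ-post : ∀ b {n'} (g : Fin n → Fin n') w → ⊗fun g id (embedᵇ b e w) ≡ embedᵇ b (λ j → g (e j)) w
  embedᵇ-post true g w with freshView k w
  ... | old j rewrite embed-old j = trans (⊗fun-↑ˡ g id (e j)) (sym (⊗fun-↑ˡ (λ j → g (e j)) id j))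
  ... | new rewrite embed-fresh = trans (⊗fun-↑ʳ g id zero) (sym (⊗fun-↑ʳ (λ j → g (e j)) id zero))
  embedᵇ-post false g w = ⊗fun-↑ˡ g id (e w)

  embedᵇ-hits-old : ∀ b w (i : Fin n) → embedᵇ b e w ≡ i ↑ˡ 1 → ∃ λ j → e j ≡ i
  embedᵇ-hits-old true w i p with freshView k w
  ... | old j = j , ↑ˡ-injective 1 _ _ (trans (sym (embed-old j)) p)
  ... | new = ⊥-elim (old≢fresh i (trans (sym p) embed-fresh))
  embedᵇ-hits-old false w i p = w , ↑ˡ-injective 1 _ _ p

record Factorisation {m n : ℕ} (u : Fin m → Fin (n + 1)) : Set where
  constructor factorisation
  field
    hits : Bool
    k : ℕ
    quotient : Surj m (shᵇ hits k)
    image : Fin k → Fin n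
    factors : ∀ z → u z ≡ embedᵇ hits image (fun quotient z)

data Comparison {m n : ℕ} {u : Fin m → Fin (n + 1)} : Factorisation u → Factorisation u → Set where
  comparison : ∀ {b k k' q q' e e' ok ok'} (c : Surj k k') →
               (∀ z → fun q' z ≡ mapᵇ b (fun c) (fun q z)) → (∀ j → e' (fun c j) ≡ e j) →
               Comparison (factorisation b k q e ok) (factorisation b k' q' e' ok')

record UniversalFactorisation {m n : ℕ} (u : Fin m → Fin (n + 1)) : Set where
  field
    canonical : Factorisation u
    universal : ∀ D → Comparison canonical D

module Avoiding {m n : ℕ} (u : Fin m → Fin (n + 1)) (allOld : ∀ z → isOld (u z) ≡ true) where

  image : Fin m → Fin n
  image z = proj₁ (isOld-true (u z) (allOld z))

  avoiding : Factorisation u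
  avoiding = factorisation false m idS image (λ z → proj₂ (isOld-true (u z) (allOld z)))

  avoiding-universal : ∀ D → Comparison avoiding D
  avoiding-universal (factorisation true k' q' e' ok') with surj q' (fresh k')
  ... | z , r = ⊥-elim (old⇒≢fresh (allOld z) (trans (ok' z) (trans (cong (embedᵇ true e') r) (embed-fresh e'))))
  avoiding-universal (factorisation false k' q' e' ok') =
    comparison q' (λ z → refl) (λ z → ↑ˡ-injective 1 _ _ (trans (sym (ok' z)) (proj₂ (isOld-true (u z) (allOld z)))))

module Hitting {m n : ℕ} (u : Fin m → Fin (n + 1)) (z₀ : Fin m) (p₀ : isOld (u z₀) ≡ false) where

  olds : Vec Bool m
  olds = tabulate (λ z → isOld (u z))

  lookup-olds : ∀ z → lookup olds z ≡ isOld (u z)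
  lookup-olds = lookup∘tabulate _

  k : ℕ
  k = count olds

  image-old : ∀ j → ∃ λ i → u (enum olds j) ≡ i ↑ˡ 1
  image-old j = isOld-true _ (trans (sym (lookup-olds _)) (enum-true olds j))

  image : Fin k → Fin n
  image j = proj₁ (image-old j)

  classify : ∀ z b → isOld (u z) ≡ b → Fin (k + 1)
  classify z true p = rank olds z (trans (lookup-olds z) p) ↑ˡ 1
  classify z false p = fresh k

  quotientFun : Fin m → Fin (k + 1)
  quotientFun z = classify z (isOld (u z)) refl

  quotient-old : ∀ z (p : isOld (u z) ≡ true) → quotientFun z ≡ rank olds z (trans (lookup-olds z) p) ↑ˡ 1
  quotient-old z p = go (isOld (u z)) refl
    where
    go : ∀ b (eq : isOld (u z) ≡ b) → classify z b eq ≡ rank olds z (trans (lookup-olds z) p) ↑ˡ 1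
    go true eq = refl
    go false eq with () ← trans (sym p) eq

  quotient-fresh : ∀ z → isOld (u z) ≡ false → quotientFun z ≡ fresh k
  quotient-fresh z p = go (isOld (u z)) refl
    where
    go : ∀ b (eq : isOld (u z) ≡ b) → classify z b eq ≡ fresh k
    go true eq with () ← trans (sym p) eq
    go false eq = refl

  quotient-surj : ∀ w → ∃ λ z → quotientFun z ≡ w
  quotient-surj w with freshView k w
  ... | old j = enum olds j , trans (quotient-old _ p) (cong (_↑ˡ 1) (rank-enum olds j _))
    where p = trans (sym (lookup-olds _)) (enum-true olds j)
  ... | new = z₀ , quotient-fresh z₀ p₀

  hitting-factors : ∀ z → u z ≡ embedᵇ true image (quotientFun z)
  hitting-factors z = go (isOld (u z)) refl
    where
    go : ∀ b → isOld (u z) ≡ b → u z ≡ embedᵇ true image (quotientFun z)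
    go true eq = trans (cong u (sym (enum-rank olds z _)))
      (trans (proj₂ (image-old _)) (trans (sym (embed-old image _)) (cong (embedᵇ true image) (sym (quotient-old z eq)))))
    go false eq = trans (isOld-false (u z) eq)
      (trans (sym (embed-fresh image)) (cong (embedᵇ true image) (sym (quotient-fresh z eq))))

  hitting : Factorisation u
  hitting = factorisation true k (surjection quotientFun quotient-surj) image hitting-factors

  hitting-universal : ∀ D → Comparison hitting D
  hitting-universal (factorisation false k' q' e' ok') =
    ⊥-elim (old≢fresh (e' (fun q' z₀)) (trans (sym (ok' z₀)) (isOld-false (u z₀) p₀)))
  hitting-universal (factorisation true k' q' e' ok') = comparison (surjection c c-surj) q'-factors image-factors
    where
    q'-old : ∀ j → ∃ λ i → fun q' (enum olds j) ≡ i ↑ˡ 1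
    q'-old j with old-or-fresh (fun q' (enum olds j))
    ... | inj₁ (i , r) = i , r
    ... | inj₂ r = ⊥-elim (old≢fresh (image j)
            (trans (sym (proj₂ (image-old j))) (trans (ok' _) (trans (cong (embedᵇ true e') r) (embed-fresh e')))))

    c : Fin k → Fin k'
    c j = proj₁ (q'-old j)

    c-surj : ∀ i → ∃ λ j → c j ≡ i
    c-surj i with surj q' (i ↑ˡ 1)
    ... | z , r = j , ↑ˡ-injective 1 _ _ (trans (sym (proj₂ (q'-old j))) (trans (cong (fun q') (enum-rank olds z _)) r))
      where
      u-z-old : isOld (u z) ≡ true
      u-z-old = trans (cong isOld (trans (ok' z) (trans (cong (embedᵇ true e') r) (embed-old e' i)))) (isOld-old (e' i))
      j = rank olds z (trans (lookup-olds z) u-z-old)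

    q'-factors : ∀ z → fun q' z ≡ mapᵇ true c (quotientFun z)
    q'-factors z = go (isOld (u z)) refl
      where
      go : ∀ b → isOld (u z) ≡ b → fun q' z ≡ mapᵇ true c (quotientFun z)
      go true eq = trans (cong (fun q') (sym (enum-rank olds z _)))
        (trans (proj₂ (q'-old _)) (sym (trans (cong (mapᵇ true c) (quotient-old z eq)) (⊗fun-↑ˡ c id _))))
      go false eq with old-or-fresh (fun q' z)
      ... | inj₁ (i , r) = ⊥-elim (old≢fresh (e' i)
              (trans (sym (trans (ok' z) (trans (cong (embedᵇ true e') r) (embed-old e' i)))) (isOld-false (u z) eq)))
      ... | inj₂ r = trans r (sym (trans (cong (mapᵇ true c) (quotient-fresh z eq)) (⊗fun-↑ʳ c id zero)))

    image-factors : ∀ j → e' (c j) ≡ image j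
    image-factors j = ↑ˡ-injective 1 _ _ (trans (sym (embed-old e' (c j)))
      (trans (cong (embedᵇ true e') (sym (proj₂ (q'-old j)))) (trans (sym (ok' _)) (proj₂ (image-old j)))))

-- The canonical factorisation keeps the old points apart (numbered by `rank`) and collapses the
-- points sent to the fresh one. Any other factorisation identifies at least as much, which
-- yields the comparison map.
universalFactorisation : ∀ {m n} (u : Fin m → Fin (n + 1)) → UniversalFactorisation u
universalFactorisation u with any? (λ z → isOld (u z) ≟ᵇ false)
... | yes (z₀ , p₀) = record { canonical = Hitting.hitting u z₀ p₀ ; universal = Hitting.hitting-universal u z₀ p₀ }
... | no none = record { canonical = Avoiding.avoiding u allOld ; universal = Avoiding.avoiding-universal u allOld }
  where
  allOld : ∀ z → isOld (u z) ≡ true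
  allOld z = ¬-not (λ p → none (z , p))

-- The Leibniz rule for δ

δᵇ : Bool → Presheaf → Presheaf
δᵇ true A = δ A
δᵇ false A = A

actᵇ : ∀ b A {m k} → Surj m (shᵇ b k) → ∣ A ∣ m → ∣ δᵇ b A ∣ k
actᵇ true A q x = act A q x
actᵇ false A q x = act A q x

record DayFactorisation (m₁ m₂ : ℕ) {n : ℕ} (f : Surj (m₁ + m₂) (n + 1)) : Set where
  constructor dayFactorisation
  field
    hits₁ hits₂ : Bool
    k₁ k₂ : ℕ
    quotient₁ : Surj m₁ (shᵇ hits₁ k₁)
    quotient₂ : Surj m₂ (shᵇ hits₂ k₂)
    image : Surj (k₁ + k₂) n
    factors₁ : ∀ z → fun f (z ↑ˡ m₂) ≡ embedᵇ hits₁ (λ j → fun image (j ↑ˡ k₂)) (fun quotient₁ z)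
    factors₂ : ∀ v → fun f (m₁ ↑ʳ v) ≡ embedᵇ hits₂ (λ j → fun image (k₁ ↑ʳ j)) (fun quotient₂ v)
open DayFactorisation

hits-some : ∀ {m₁ m₂ n} {f : Surj (m₁ + m₂) (n + 1)} (D : DayFactorisation m₁ m₂ f) → T (hits₁ D ∨ hits₂ D)
hits-some (dayFactorisation true _ _ _ _ _ _ _ _) = tt
hits-some (dayFactorisation false true _ _ _ _ _ _ _) = tt
hits-some {m₁} {m₂} {n} {f} (dayFactorisation false false _ _ _ _ _ ok₁ ok₂) with surj f (fresh n)
... | w , r with splitView m₁ m₂ w
... | left z = ⊥-elim (old≢fresh _ (trans (sym (ok₁ z)) r))
... | right v = ⊥-elim (old≢fresh _ (trans (sym (ok₂ v)) r))

restrict : ∀ {A B m₁ m₂ n} {f : Surj (m₁ + m₂) (n + 1)} (D : DayFactorisation m₁ m₂ f) →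
           ∣ A ∣ m₁ → ∣ B ∣ m₂ → DayEl (δᵇ (hits₁ D) A) (δᵇ (hits₂ D) B) n
restrict {A} {B} D x y = el (k₁ D) (k₂ D) (actᵇ (hits₁ D) A (quotient₁ D) x) (actᵇ (hits₂ D) B (quotient₂ D) y) (image D)

canonicalDayFactorisation : ∀ m₁ m₂ {n} (f : Surj (m₁ + m₂) (n + 1)) → DayFactorisation m₁ m₂ f
canonicalDayFactorisation m₁ m₂ {n} f =
  dayFactorisation (hits C₁) (hits C₂) (k C₁) (k C₂) (quotient C₁) (quotient C₂) (surjection joint joint-surj)
    (λ z → trans (factors C₁ z) (embedᵇ-cong (image C₁) (hits C₁) (λ j → sym (joint-↑ˡ j)) _))
    (λ v → trans (factors C₂ v) (embedᵇ-cong (image C₂) (hits C₂) (λ j → sym (joint-↑ʳ j)) _))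
  where
  open Factorisation
  C₁ = UniversalFactorisation.canonical (universalFactorisation (λ z → fun f (z ↑ˡ m₂)))
  C₂ = UniversalFactorisation.canonical (universalFactorisation (λ v → fun f (m₁ ↑ʳ v)))
  joint : Fin (k C₁ + k C₂) → Fin n
  joint w = [ image C₁ , image C₂ ]′ (splitAt (k C₁) w)
  joint-↑ˡ : ∀ j → joint (j ↑ˡ k C₂) ≡ image C₁ j
  joint-↑ˡ j rewrite splitAt-↑ˡ (k C₁) j (k C₂) = refl
  joint-↑ʳ : ∀ j → joint (k C₁ ↑ʳ j) ≡ image C₂ j
  joint-↑ʳ j rewrite splitAt-↑ʳ (k C₁) (k C₂) j = refl
  joint-surj : ∀ i → ∃ λ w → joint w ≡ i
  joint-surj i with surj f (i ↑ˡ 1)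
  ... | w , r with splitView m₁ m₂ w
  ... | left z with embedᵇ-hits-old (image C₁) (hits C₁) _ i (trans (sym (factors C₁ z)) r)
  ...   | j , s = j ↑ˡ k C₂ , trans (joint-↑ˡ j) s
  joint-surj i | w , r | right v with embedᵇ-hits-old (image C₂) (hits C₂) _ i (trans (sym (factors C₂ v)) r)
  ...   | j , s = k C₁ ↑ʳ j , trans (joint-↑ʳ j) s

-- The summands δA ⊗̂ B, A ⊗̂ δB and δA ⊗̂ δB, indexed by the factors that carry the fresh point.
record Leibniz (A B : Presheaf) (n : ℕ) : Set where
  constructor leibniz
  field
    left? right? : Bool
    .some : T (left? ∨ right?)
    summand : DayEl (δᵇ left? A) (δᵇ right? B) n

data Leibniz≈ {A B : Presheaf} {n : ℕ} : Leibniz A B n → Leibniz A B n → Set where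
  leibniz≈ : ∀ {b₁ b₂} .{p} {d d' : DayEl (δᵇ b₁ A) (δᵇ b₂ B) n} →
             (δᵇ b₁ A ⊗̂ δᵇ b₂ B) ⊢ d ≈ d' → Leibniz≈ (leibniz b₁ b₂ p d) (leibniz b₁ b₂ p d')

Leibniz≈-isEquivalence : ∀ {A B n} → IsEquivalence (Leibniz≈ {A} {B} {n})
Leibniz≈-isEquivalence {A} {B} = record
  { refl = λ { {leibniz b₁ b₂ p d} → leibniz≈ {p = p} (Fibre.refl (δᵇ b₁ A ⊗̂ δᵇ b₂ B)) }
  ; sym = λ { (leibniz≈ {b₁} {b₂} {p} r) → leibniz≈ {p = p} (Fibre.sym (δᵇ b₁ A ⊗̂ δᵇ b₂ B) r) }
  ; trans = λ { (leibniz≈ {b₁} {b₂} {p} r) (leibniz≈ s) → leibniz≈ {p = p} (Fibre.trans (δᵇ b₁ A ⊗̂ δᵇ b₂ B) r s) } }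

module Leibniz≈-equiv {A B n} = IsEquivalence (Leibniz≈-isEquivalence {A} {B} {n})

-- The paper's 𝓗; `merge` below is its inverse [str, str', ρ].
split : ∀ {A B n} → ∣ δ (A ⊗̂ B) ∣ n → Leibniz A B n
split {A} {B} (el m₁ m₂ x y f) = leibniz (hits₁ D) (hits₂ D) (hits-some D) (restrict {A} {B} D x y)
  where D = canonicalDayFactorisation m₁ m₂ f

actᵇ-factor : ∀ b A {m k k'} (q : Surj m (shᵇ b k)) (q' : Surj m (shᵇ b k')) (c : Surj k k') →
              (∀ z → fun q' z ≡ mapᵇ b (fun c) (fun q z)) →
              ∀ x → δᵇ b A ⊢ actᵇ b A q' x ≈ act (δᵇ b A) c (actᵇ b A q x)
actᵇ-factor true A q q' c fc x = Fibre.trans A (act-cong A fc (Fibre.refl A)) (act-∘ A (c ⊗S idS) q x)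
actᵇ-factor false A q q' c fc x = Fibre.trans A (act-cong A fc (Fibre.refl A)) (act-∘ A c q x)

split-unique : ∀ {A B m₁ m₂ n} (x : ∣ A ∣ m₁) (y : ∣ B ∣ m₂) (f : Surj (m₁ + m₂) (n + 1)) (D : DayFactorisation m₁ m₂ f) →
               Leibniz≈ (split (el m₁ m₂ x y f)) (leibniz (hits₁ D) (hits₂ D) (hits-some D) (restrict {A} {B} D x y))
split-unique {A} {B} {m₁} {m₂} x y f (dayFactorisation b₁ b₂ k₁ k₂ q₁ q₂ g ok₁ ok₂)
  with UniversalFactorisation.universal (universalFactorisation (λ z → fun f (z ↑ˡ m₂))) (factorisation b₁ k₁ q₁ (λ j → fun g (j ↑ˡ k₂)) ok₁)
     | UniversalFactorisation.universal (universalFactorisation (λ v → fun f (m₁ ↑ʳ v))) (factorisation b₂ k₂ q₂ (λ j → fun g (k₁ ↑ʳ j)) ok₂)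
... | comparison c₁ q-fac₁ e-fac₁ | comparison c₂ q-fac₂ e-fac₂ =
  leibniz≈ (Fibre.sym (δᵇ b₁ A ⊗̂ δᵇ b₂ B)
    (Fibre.trans (δᵇ b₁ A ⊗̂ δᵇ b₂ B) (day-cmp (actᵇ-factor b₁ A _ q₁ c₁ q-fac₁ x) (actᵇ-factor b₂ B _ q₂ c₂ q-fac₂ y) (λ _ → refl))
      (Fibre.trans (δᵇ b₁ A ⊗̂ δᵇ b₂ B) (day-step (coend c₁ c₂ _ _ g)) (day-≗ joint-factors))))
  where
  C = canonicalDayFactorisation m₁ m₂ f
  joint-factors : (g ∘S (c₁ ⊗S c₂)) ≗S image C
  joint-factors w with splitView (DayFactorisation.k₁ C) (DayFactorisation.k₂ C) w
  ... | left j rewrite ⊗fun-↑ˡ (fun c₁) (fun c₂) j | splitAt-↑ˡ (DayFactorisation.k₁ C) j (DayFactorisation.k₂ C) = e-fac₁ j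
  ... | right j rewrite ⊗fun-↑ʳ (fun c₁) (fun c₂) j | splitAt-↑ʳ (DayFactorisation.k₁ C) (DayFactorisation.k₂ C) j = e-fac₂ j

module _ {m₁ m₂ n : ℕ} where

  DayFactorisation-≗ : ∀ {f f' : Surj (m₁ + m₂) (n + 1)} → f ≗S f' → DayFactorisation m₁ m₂ f' → DayFactorisation m₁ m₂ f
  DayFactorisation-≗ r (dayFactorisation b₁ b₂ k₁ k₂ q₁ q₂ g ok₁ ok₂) =
    dayFactorisation b₁ b₂ k₁ k₂ q₁ q₂ g (λ z → trans (r _) (ok₁ z)) (λ v → trans (r _) (ok₂ v))

  postcompose : ∀ {f : Surj (m₁ + m₂) (n + 1)} {n'} → DayFactorisation m₁ m₂ f → (h : Surj n n') →
                DayFactorisation m₁ m₂ ((h ⊗S idS {1}) ∘S f)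
  postcompose (dayFactorisation b₁ b₂ k₁ k₂ q₁ q₂ g ok₁ ok₂) h =
    dayFactorisation b₁ b₂ k₁ k₂ q₁ q₂ (h ∘S g)
      (λ z → trans (cong (⊗fun (fun h) id) (ok₁ z)) (embedᵇ-post _ b₁ (fun h) _))
      (λ v → trans (cong (⊗fun (fun h) id) (ok₂ v)) (embedᵇ-post _ b₂ (fun h) _))

precompose : ∀ {m₁ m₂ m₁' m₂' n} {f : Surj (m₁' + m₂') (n + 1)} → DayFactorisation m₁' m₂' f →
             (g₁ : Surj m₁ m₁') (g₂ : Surj m₂ m₂') → DayFactorisation m₁ m₂ (f ∘S (g₁ ⊗S g₂))
precompose {f = f} (dayFactorisation b₁ b₂ k₁ k₂ q₁ q₂ g ok₁ ok₂) g₁ g₂ =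
  dayFactorisation b₁ b₂ k₁ k₂ (q₁ ∘S g₁) (q₂ ∘S g₂) g
    (λ z → trans (cong (fun f) (⊗fun-↑ˡ (fun g₁) (fun g₂) z)) (ok₁ _))
    (λ v → trans (cong (fun f) (⊗fun-↑ʳ (fun g₁) (fun g₂) v)) (ok₂ _))

actᵇ-cong : ∀ b A {m k} (q : Surj m (shᵇ b k)) {x x' : ∣ A ∣ m} → A ⊢ x ≈ x' → δᵇ b A ⊢ actᵇ b A q x ≈ actᵇ b A q x'
actᵇ-cong true A q p = act-cong A (λ _ → refl) p
actᵇ-cong false A q p = act-cong A (λ _ → refl) p

actᵇ-∘ : ∀ b A {m m' k} (q : Surj m' (shᵇ b k)) (g : Surj m m') x → δᵇ b A ⊢ actᵇ b A q (act A g x) ≈ actᵇ b A (q ∘S g) x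
actᵇ-∘ true A q g x = Fibre.sym A (act-∘ A q g x)
actᵇ-∘ false A q g x = Fibre.sym A (act-∘ A q g x)

split-step : ∀ {A B n} {e e' : DayEl A B (n + 1)} → DayStep A B e e' → Leibniz≈ (split e) (split e')
split-step {A} {B} (cmp {m₁} {m₂} {x} {x'} {y} {y'} {f} {f'} p q r) =
  Leibniz≈-equiv.trans (split-unique x y f (DayFactorisation-≗ r C'))
    (leibniz≈ (day-cmp (actᵇ-cong (hits₁ C') A (quotient₁ C') p) (actᵇ-cong (hits₂ C') B (quotient₂ C') q) (λ _ → refl)))
  where C' = canonicalDayFactorisation m₁ m₂ f'
split-step {A} {B} (coend {m₁' = m₁'} {m₂'} g₁ g₂ x y f) =
  Leibniz≈-equiv.trans
    (leibniz≈ (day-cmp (actᵇ-∘ (hits₁ C) A (quotient₁ C) g₁ x) (actᵇ-∘ (hits₂ C) B (quotient₂ C) g₂ y) (λ _ → refl)))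
    (Leibniz≈-equiv.sym (split-unique x y _ (precompose C g₁ g₂)))
  where C = canonicalDayFactorisation m₁' m₂' f

split-cong : ∀ {A B n} {e e' : ∣ δ (A ⊗̂ B) ∣ n} → δ (A ⊗̂ B) ⊢ e ≈ e' → Leibniz≈ (split e) (split e')
split-cong = gfold Leibniz≈-isEquivalence split split-step

leibnizAct : ∀ {A B n n'} → Surj n n' → Leibniz A B n → Leibniz A B n'
leibnizAct {A} {B} h (leibniz b₁ b₂ p d) = leibniz b₁ b₂ p (act (δᵇ b₁ A ⊗̂ δᵇ b₂ B) h d)

split-nat : ∀ {A B n n'} (h : Surj n n') (e : ∣ δ (A ⊗̂ B) ∣ n) → Leibniz≈ (split (act (δ (A ⊗̂ B)) h e)) (leibnizAct h (split e))
split-nat h (el m₁ m₂ x y f) = split-unique x y _ (postcompose (canonicalDayFactorisation m₁ m₂ f) h)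

δᵇHom : ∀ b {A A'} → Hom A A' → Hom (δᵇ b A) (δᵇ b A')
δᵇHom true α = δHom α
δᵇHom false α = α

leibnizMap : ∀ {A A' B B' n} → Hom A A' → Hom B B' → Leibniz A B n → Leibniz A' B' n
leibnizMap α β (leibniz b₁ b₂ p d) = leibniz b₁ b₂ p (⊗map (app (δᵇHom b₁ α)) (app (δᵇHom b₂ β)) d)

actᵇ-map : ∀ b {A A'} (α : Hom A A') {m k} (q : Surj m (shᵇ b k)) x → δᵇ b A' ⊢ actᵇ b A' q (app α x) ≈ app (δᵇHom b α) (actᵇ b A q x)
actᵇ-map true {A' = A'} α q x = Fibre.sym A' (app-nat α q x)
actᵇ-map false {A' = A'} α q x = Fibre.sym A' (app-nat α q x)

split-map : ∀ {A A' B B' n} (α : Hom A A') (β : Hom B B') (e : ∣ δ (A ⊗̂ B) ∣ n) →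
            Leibniz≈ (split (⊗map (app α) (app β) e)) (leibnizMap α β (split e))
split-map α β (el m₁ m₂ x y f) =
  leibniz≈ (day-cmp (actᵇ-map (hits₁ C) α (quotient₁ C) x) (actᵇ-map (hits₂ C) β (quotient₂ C) y) (λ _ → refl))
  where C = canonicalDayFactorisation m₁ m₂ f


module _ (m₁ m₂ : ℕ) where

  private
    castθ : Fin (m₁ + (m₂ + 1)) → Fin ((m₁ + m₂) + 1)
    castθ = cast (sym (+-assoc m₁ m₂ 1))

  θ-old : ∀ (j : Fin m₁) → fun (θS m₁ m₂) ((j ↑ˡ 1) ↑ˡ m₂) ≡ (j ↑ˡ m₂) ↑ˡ 1
  θ-old j = trans (cong (λ w → castθ (⊗fun id (σfun 1 m₂) w)) (↑ˡ↑ˡ-assocʳ (+-assoc m₁ 1 m₂) j))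
    (trans (cong castθ (⊗fun-↑ˡ id (σfun 1 m₂) j)) (↑ˡ↑ˡ-assocˡ (sym (+-assoc m₁ m₂ 1)) j))

  θ-fresh : fun (θS m₁ m₂) (fresh m₁ ↑ˡ m₂) ≡ fresh (m₁ + m₂)
  θ-fresh = trans (cong (λ w → castθ (⊗fun id (σfun 1 m₂) w)) (↑ʳ↑ˡ-assocʳ {m₁} {1} {m₂} (+-assoc m₁ 1 m₂) zero))
    (trans (cong castθ (trans (⊗fun-↑ʳ {m₁} {1 + m₂} id (σfun 1 m₂) (zero ↑ˡ m₂)) (cong (m₁ ↑ʳ_) (σfun-↑ˡ 1 m₂ zero))))
      (↑ʳ↑ʳ-assocˡ {m₁} {m₂} {1} (sym (+-assoc m₁ m₂ 1)) zero))

  θ-right : ∀ (v : Fin m₂) → fun (θS m₁ m₂) ((m₁ + 1) ↑ʳ v) ≡ (m₁ ↑ʳ v) ↑ˡ 1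
  θ-right v = trans (cong (λ w → castθ (⊗fun id (σfun 1 m₂) w)) (↑ʳ↑ʳ-assocʳ {m₁} {1} {m₂} (+-assoc m₁ 1 m₂) v))
    (trans (cong castθ (trans (⊗fun-↑ʳ {m₁} {1 + m₂} id (σfun 1 m₂) (1 ↑ʳ v)) (cong (m₁ ↑ʳ_) (σfun-↑ʳ 1 m₂ v))))
      (↑ʳ↑ˡ-assocˡ {m₁} {m₂} {1} (sym (+-assoc m₁ m₂ 1)) v))

module _ (n : ℕ) where

  private
    c : Fin (n + (1 + 1)) → Fin (n + 1)
    c = ⊗fun id (λ _ → zero)

  contS-old : ∀ (w : Fin (n + 1)) → fun (contS n) (w ↑ˡ 1) ≡ w
  contS-old w with freshView n w
  ... | old i = trans (cong c (↑ˡ↑ˡ-assocʳ (+-assoc n 1 1) i)) (⊗fun-↑ˡ id (λ _ → zero) i)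
  ... | new = trans (cong c (↑ʳ↑ˡ-assocʳ {n} {1} {1} (+-assoc n 1 1) zero)) (⊗fun-↑ʳ {n} {1 + 1} id (λ _ → zero) (zero {0} ↑ˡ 1))

  contS-fresh : fun (contS n) (fresh (n + 1)) ≡ fresh n
  contS-fresh = trans (cong c (↑ʳ↑ʳ-assocʳ {n} {1} {1} (+-assoc n 1 1) zero)) (⊗fun-↑ʳ {n} {1 + 1} id (λ _ → zero) (1 ↑ʳ zero))

module _ (k₁ k₂ : ℕ) {n : ℕ} (g : Surj (k₁ + k₂) n) where

  private
    g₁ : Fin k₁ → Fin n
    g₁ j = fun g (j ↑ˡ k₂)
    g₂ : Fin k₂ → Fin n
    g₂ j = fun g (k₁ ↑ʳ j)
    g⊗1 : Fin ((k₁ + k₂) + 1) → Fin (n + 1)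
    g⊗1 = ⊗fun (fun g) id

  strS : Surj ((k₁ + 1) + k₂) (n + 1)
  strS = (g ⊗S idS {1}) ∘S θS k₁ k₂

  str'S : Surj (k₁ + (k₂ + 1)) (n + 1)
  str'S = (g ⊗S idS {1}) ∘S castS (sym (+-assoc k₁ k₂ 1))

  ρS : Surj ((k₁ + 1) + (k₂ + 1)) (n + 1)
  ρS = contS n ∘S ((strS ⊗S idS {1}) ∘S castS (sym (+-assoc (k₁ + 1) k₂ 1)))

  strS-↑ˡ : ∀ w → fun strS (w ↑ˡ k₂) ≡ embedᵇ true g₁ w
  strS-↑ˡ w with freshView k₁ w
  ... | old j = trans (cong g⊗1 (θ-old k₁ k₂ j)) (trans (⊗fun-↑ˡ (fun g) id (j ↑ˡ k₂)) (sym (embed-old g₁ j)))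
  ... | new = trans (cong g⊗1 (θ-fresh k₁ k₂)) (trans (⊗fun-↑ʳ {k₁ + k₂} (fun g) id zero) (sym (embed-fresh g₁)))

  strS-↑ʳ : ∀ v → fun strS ((k₁ + 1) ↑ʳ v) ≡ embedᵇ false g₂ v
  strS-↑ʳ v = trans (cong g⊗1 (θ-right k₁ k₂ v)) (⊗fun-↑ˡ (fun g) id (k₁ ↑ʳ v))

  str'S-↑ˡ : ∀ w → fun str'S (w ↑ˡ (k₂ + 1)) ≡ embedᵇ false g₁ w
  str'S-↑ˡ w = trans (cong g⊗1 (↑ˡ↑ˡ-assocˡ {k₁} {k₂} {1} (sym (+-assoc k₁ k₂ 1)) w)) (⊗fun-↑ˡ (fun g) id (w ↑ˡ k₂))

  str'S-↑ʳ : ∀ v → fun str'S (k₁ ↑ʳ v) ≡ embedᵇ true g₂ v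
  str'S-↑ʳ v with freshView k₂ v
  ... | old j = trans (cong g⊗1 (↑ʳ↑ˡ-assocˡ {k₁} {k₂} {1} (sym (+-assoc k₁ k₂ 1)) j))
                  (trans (⊗fun-↑ˡ (fun g) id (k₁ ↑ʳ j)) (sym (embed-old g₂ j)))
  ... | new = trans (cong g⊗1 (↑ʳ↑ʳ-assocˡ {k₁} {k₂} {1} (sym (+-assoc k₁ k₂ 1)) zero))
                (trans (⊗fun-↑ʳ {k₁ + k₂} (fun g) id zero) (sym (embed-fresh g₂)))

  private
    cont∘strS⊗1 : Fin (((k₁ + 1) + k₂) + 1) → Fin (n + 1)
    cont∘strS⊗1 t = fun (contS n) (⊗fun (fun strS) id t)

  ρS-↑ˡ : ∀ w → fun ρS (w ↑ˡ (k₂ + 1)) ≡ embedᵇ true g₁ w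
  ρS-↑ˡ w = trans (cong cont∘strS⊗1 (↑ˡ↑ˡ-assocˡ {k₁ + 1} {k₂} {1} (sym (+-assoc (k₁ + 1) k₂ 1)) w))
    (trans (cong (fun (contS n)) (⊗fun-↑ˡ (fun strS) id (w ↑ˡ k₂))) (trans (contS-old n _) (strS-↑ˡ w)))

  ρS-↑ʳ : ∀ v → fun ρS ((k₁ + 1) ↑ʳ v) ≡ embedᵇ true g₂ v
  ρS-↑ʳ v with freshView k₂ v
  ... | old j = trans (cong cont∘strS⊗1 (↑ʳ↑ˡ-assocˡ {k₁ + 1} {k₂} {1} (sym (+-assoc (k₁ + 1) k₂ 1)) j))
    (trans (cong (fun (contS n)) (⊗fun-↑ˡ (fun strS) id ((k₁ + 1) ↑ʳ j)))
      (trans (contS-old n _) (trans (strS-↑ʳ j) (sym (embed-old g₂ j)))))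
  ... | new = trans (cong cont∘strS⊗1 (↑ʳ↑ʳ-assocˡ {k₁ + 1} {k₂} {1} (sym (+-assoc (k₁ + 1) k₂ 1)) zero))
    (trans (cong (fun (contS n)) (⊗fun-↑ʳ {(k₁ + 1) + k₂} (fun strS) id zero))
      (trans (contS-fresh n) (sym (embed-fresh g₂))))

  strS-factorisation : DayFactorisation (k₁ + 1) k₂ strS
  strS-factorisation = dayFactorisation true false k₁ k₂ idS idS g strS-↑ˡ strS-↑ʳ

  str'S-factorisation : DayFactorisation k₁ (k₂ + 1) str'S
  str'S-factorisation = dayFactorisation false true k₁ k₂ idS idS g str'S-↑ˡ str'S-↑ʳ

  ρS-factorisation : DayFactorisation (k₁ + 1) (k₂ + 1) ρS
  ρS-factorisation = dayFactorisation true true k₁ k₂ idS idS g ρS-↑ˡ ρS-↑ʳ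

merge : ∀ {A B n} → Leibniz A B n → ∣ δ (A ⊗̂ B) ∣ n
merge {A} {B} (leibniz true false _ d) = str {A} {B} d
merge {A} {B} (leibniz false true _ d) = str' {A} {B} d
merge {A} {B} (leibniz true true _ d) = ρ {A} {B} d
merge (leibniz false false () d)

split-merge : ∀ {A B n} (h : Leibniz A B n) → Leibniz≈ (split (merge h)) h
split-merge {A} {B} (leibniz true false p (el k₁ k₂ x y g)) =
  Leibniz≈-equiv.trans (split-unique x y _ (strS-factorisation k₁ k₂ g)) (leibniz≈ (day-cmp (act-id A x) (act-id B y) (λ _ → refl)))
split-merge {A} {B} (leibniz false true p (el k₁ k₂ x y g)) =
  Leibniz≈-equiv.trans (split-unique x y _ (str'S-factorisation k₁ k₂ g)) (leibniz≈ (day-cmp (act-id A x) (act-id B y) (λ _ → refl)))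
split-merge {A} {B} (leibniz true true p (el k₁ k₂ x y g)) =
  Leibniz≈-equiv.trans (split-unique x y _ (ρS-factorisation k₁ k₂ g)) (leibniz≈ (day-cmp (act-id A x) (act-id B y) (λ _ → refl)))
split-merge (leibniz false false () d)

module _ {A B : Presheaf} {m₁ m₂ n : ℕ} {x : ∣ A ∣ m₁} {y : ∣ B ∣ m₂} {f : Surj (m₁ + m₂) (n + 1)} where

  reassemble : (D : DayFactorisation m₁ m₂ f) (M : Surj (shᵇ (hits₁ D) (k₁ D) + shᵇ (hits₂ D) (k₂ D)) (n + 1)) →
               (∀ w → fun M (w ↑ˡ shᵇ (hits₂ D) (k₂ D)) ≡ embedᵇ (hits₁ D) (λ j → fun (image D) (j ↑ˡ k₂ D)) w) →
               (∀ v → fun M (shᵇ (hits₁ D) (k₁ D) ↑ʳ v) ≡ embedᵇ (hits₂ D) (λ j → fun (image D) (k₁ D ↑ʳ j)) v) →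
               (A ⊗̂ B) ⊢ el _ _ (act A (quotient₁ D) x) (act B (quotient₂ D) y) M ≈ el m₁ m₂ x y f
  reassemble (dayFactorisation b₁ b₂ k₁ k₂ q₁ q₂ g ok₁ ok₂) M M₁ M₂ =
    Fibre.trans (A ⊗̂ B) (day-step (coend q₁ q₂ x y M)) (day-≗ M-factors)
    where
    M-factors : (M ∘S (q₁ ⊗S q₂)) ≗S f
    M-factors w with splitView m₁ m₂ w
    ... | left z = trans (cong (fun M) (⊗fun-↑ˡ (fun q₁) (fun q₂) z)) (trans (M₁ _) (sym (ok₁ z)))
    ... | right v = trans (cong (fun M) (⊗fun-↑ʳ (fun q₁) (fun q₂) v)) (trans (M₂ _) (sym (ok₂ v)))

  merge-restrict : (D : DayFactorisation m₁ m₂ f) →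
                   δ (A ⊗̂ B) ⊢ merge (leibniz (hits₁ D) (hits₂ D) (hits-some D) (restrict {A} {B} D x y)) ≈ el m₁ m₂ x y f
  merge-restrict D@(dayFactorisation true false k₁ k₂ _ _ g _ _) = reassemble D (strS k₁ k₂ g) (strS-↑ˡ k₁ k₂ g) (strS-↑ʳ k₁ k₂ g)
  merge-restrict D@(dayFactorisation false true k₁ k₂ _ _ g _ _) = reassemble D (str'S k₁ k₂ g) (str'S-↑ˡ k₁ k₂ g) (str'S-↑ʳ k₁ k₂ g)
  merge-restrict D@(dayFactorisation true true k₁ k₂ _ _ g _ _) = reassemble D (ρS k₁ k₂ g) (ρS-↑ˡ k₁ k₂ g) (ρS-↑ʳ k₁ k₂ g)
  merge-restrict D@(dayFactorisation false false _ _ _ _ _ _ _) = ⊥-elim (hits-some D)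

merge-split : ∀ {A B n} (e : ∣ δ (A ⊗̂ B) ∣ n) → δ (A ⊗̂ B) ⊢ merge (split e) ≈ e
merge-split (el m₁ m₂ x y f) = merge-restrict (canonicalDayFactorisation m₁ m₂ f)


-- Commuting δ past δⁿ

shS : ∀ n {m m'} → Surj m m' → Surj (sh m n) (sh m' n)
shS zero f = f
shS (suc n) f = shS n (f ⊗S idS {1})

module _ (X : Presheaf) where

  get-act : ∀ n {m m'} (f : Surj m m') (x : ∣ δ^ n X ∣ m) → get X n (act (δ^ n X) f x) ≡ act X (shS n f) (get X n x)
  get-act zero f x = refl
  get-act (suc n) f x = get-act n (f ⊗S idS {1}) x

  get-cong : ∀ n {m} {x y : ∣ δ^ n X ∣ m} → δ^ n X ⊢ x ≈ y → X ⊢ get X n x ≈ get X n y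
  get-cong zero p = p
  get-cong (suc n) p = get-cong n p

  get-reflects-≈ : ∀ n {m} {x y : ∣ δ^ n X ∣ m} → X ⊢ get X n x ≈ get X n y → δ^ n X ⊢ x ≈ y
  get-reflects-≈ zero p = p
  get-reflects-≈ (suc n) p = get-reflects-≈ n p

  get-put : ∀ n {m} (x : ∣ X ∣ (sh m n)) → get X n {m} (put X n x) ≡ x
  get-put zero x = refl
  get-put (suc n) x = get-put n x

get-app : ∀ {X Y} n (k : Hom X Y) {m} (x : ∣ δ^ n X ∣ m) → get Y n (app (δ^Hom n k) x) ≡ app k (get X n x)
get-app zero k x = refl
get-app (suc n) k x = get-app n k x

-- Up to casts sh m n is m + n: `base` are the m given points, `added` the n points adjoined by δⁿ.
base : ∀ m n → Fin m → Fin (sh m n)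
base m n a = cast (sym (sh≡ m n)) (a ↑ˡ n)

added : ∀ m n → Fin n → Fin (sh m n)
added m n v = cast (sym (sh≡ m n)) (m ↑ʳ v)

data ShView (m n : ℕ) : Fin (sh m n) → Set where
  base′ : (a : Fin m) → ShView m n (base m n a)
  added′ : (v : Fin n) → ShView m n (added m n v)

shView : ∀ m n z → ShView m n z
shView m n z = subst (ShView m n) (cast-involutive (sym (sh≡ m n)) (sh≡ m n) z) (go (cast (sh≡ m n) z))
  where
  go : (w : Fin (m + n)) → ShView m n (cast (sym (sh≡ m n)) w)
  go w with splitView m n w
  ... | left a = base′ a
  ... | right v = added′ v

shS-cast : ∀ n {m m'} (g : Surj m m') (w : Fin (m + n)) →
           fun (shS n g) (cast (sym (sh≡ m n)) w) ≡ cast (sym (sh≡ m' n)) (⊗fun (fun g) id w)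
shS-cast zero {m} {m'} g w with splitView m 0 w
... | left a = trans (cong (fun g) (cast-≡ _ (toℕ-↑ˡ a 0)))
                     (sym (cast-≡ _ (trans (cong toℕ (⊗fun-↑ˡ (fun g) id a)) (toℕ-↑ˡ (fun g a) 0))))
shS-cast (suc n) {m} {m'} g w =
  trans (cong (fun (shS n (g ⊗S idS {1}))) (sym (cast-trans (sym (+-assoc m 1 n)) (sym (sh≡ (m + 1) n)) w)))
    (trans (shS-cast n (g ⊗S idS {1}) (cast (sym (+-assoc m 1 n)) w))
      (trans (cong (cast (sym (sh≡ (m' + 1) n))) (reassociate w))
        (cast-trans (sym (+-assoc m' 1 n)) (sym (sh≡ (m' + 1) n)) _)))
  where
  g⊗1⊗n : Fin ((m + 1) + n) → Fin ((m' + 1) + n)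
  g⊗1⊗n = ⊗fun (⊗fun (fun g) id) id
  reassociate : ∀ w → g⊗1⊗n (cast (sym (+-assoc m 1 n)) w) ≡ cast (sym (+-assoc m' 1 n)) (⊗fun (fun g) id w)
  reassociate w with splitView m (suc n) w
  ... | left a = trans (cong g⊗1⊗n (↑ˡ↑ˡ-assocˡ {m} {1} {n} _ a))
      (trans (⊗fun-↑ˡ (⊗fun (fun g) id) id (a ↑ˡ 1))
        (trans (cong (_↑ˡ n) (⊗fun-↑ˡ (fun g) id a))
          (trans (sym (↑ˡ↑ˡ-assocˡ {m'} {1} {n} _ (fun g a))) (cong (cast _) (sym (⊗fun-↑ˡ (fun g) id a))))))
  ... | right zero = trans (cong g⊗1⊗n (↑ʳ↑ˡ-assocˡ {m} {1} {n} _ zero))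
      (trans (⊗fun-↑ˡ (⊗fun (fun g) id) (id {n}) (m ↑ʳ zero))
        (trans (cong (_↑ˡ n) (⊗fun-↑ʳ {m} (fun g) (id {1}) zero))
          (trans (sym (↑ʳ↑ˡ-assocˡ {m'} {1} {n} _ zero)) (cong (cast _) (sym (⊗fun-↑ʳ {m} (fun g) (id {suc n}) zero))))))
  ... | right (suc v) = trans (cong g⊗1⊗n (↑ʳ↑ʳ-assocˡ {m} {1} {n} _ v))
      (trans (⊗fun-↑ʳ {m + 1} (⊗fun (fun g) id) (id {n}) v)
        (trans (sym (↑ʳ↑ʳ-assocˡ {m'} {1} {n} _ v)) (cong (cast _) (sym (⊗fun-↑ʳ {m} (fun g) (id {suc n}) (suc v))))))

shS-base : ∀ n {m m'} (g : Surj m m') a → fun (shS n g) (base m n a) ≡ base m' n (fun g a)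
shS-base n g a = trans (shS-cast n g (a ↑ˡ n)) (cong (cast _) (⊗fun-↑ˡ (fun g) id a))

shS-added : ∀ n {m m'} (g : Surj m m') v → fun (shS n g) (added m n v) ≡ added m' n v
shS-added n {m} g v = trans (shS-cast n g (m ↑ʳ v)) (cong (cast _) (⊗fun-↑ʳ {m} (fun g) id v))

toℕ-base : ∀ m n a → toℕ (base m n a) ≡ toℕ a
toℕ-base m n a = trans (toℕ-cast _ (a ↑ˡ n)) (toℕ-↑ˡ a n)

toℕ-added : ∀ m n v → toℕ (added m n v) ≡ m + toℕ v
toℕ-added m n v = trans (toℕ-cast _ (m ↑ʳ v)) (toℕ-↑ʳ m v)

cast-conj : ∀ {a b c d} (f : Fin a → Fin b) .(e₁ : c ≡ a) .(e₂ : b ≡ d) {w : Fin c} (u : Fin a) {t : Fin d} →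
            toℕ w ≡ toℕ u → toℕ (f u) ≡ toℕ t → cast e₂ (f (cast e₁ w)) ≡ t
cast-conj f e₁ e₂ u p q = cast-≡ e₂ (trans (cong (λ x → toℕ (f x)) (cast-≡ e₁ p)) q)

module _ (m n : ℕ) where

  private
    τ-block : Fin (m + (1 + n)) → Fin (m + (n + 1))
    τ-block = ⊗fun id (σfun 1 n)
    τ⁻¹-block : Fin (m + (n + 1)) → Fin (m + (1 + n))
    τ⁻¹-block = ⊗fun id (σfun n 1)

  swapS-base-old : ∀ a → fun (swapS m n) (base (m + 1) n (a ↑ˡ 1)) ≡ base m n a ↑ˡ 1
  swapS-base-old a = cast-conj τ-block _ _ (a ↑ˡ (1 + n))
    (trans (toℕ-base (m + 1) n (a ↑ˡ 1)) (trans (toℕ-↑ˡ a 1) (sym (toℕ-↑ˡ a (1 + n)))))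
    (trans (cong toℕ (⊗fun-↑ˡ id (σfun 1 n) a)) (trans (toℕ-↑ˡ a (n + 1)) (sym (trans (toℕ-↑ˡ _ 1) (toℕ-base m n a)))))

  swapS-base-fresh : fun (swapS m n) (base (m + 1) n (fresh m)) ≡ fresh (sh m n)
  swapS-base-fresh = cast-conj τ-block _ _ (m ↑ʳ (zero ↑ˡ n))
    (trans (toℕ-base (m + 1) n (fresh m)) (trans (toℕ-↑ʳ m zero) (sym (trans (toℕ-↑ʳ m _) (cong (m +_) (toℕ-↑ˡ (zero {0}) n))))))
    (trans (cong toℕ (trans (⊗fun-↑ʳ {m} id (σfun 1 n) (zero ↑ˡ n)) (cong (m ↑ʳ_) (σfun-↑ˡ 1 n zero))))
      (trans (toℕ-↑ʳ m (n ↑ʳ zero)) (trans (cong (m +_) (toℕ-↑ʳ n zero))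
        (trans (sym (+-assoc m n 0)) (sym (trans (toℕ-↑ʳ (sh m n) zero) (cong (_+ 0) (sh≡ m n))))))))

  swapS-added : ∀ v → fun (swapS m n) (added (m + 1) n v) ≡ added m n v ↑ˡ 1
  swapS-added v = cast-conj τ-block _ _ (m ↑ʳ (1 ↑ʳ v))
    (trans (toℕ-added (m + 1) n v) (trans (+-assoc m 1 (toℕ v)) (sym (trans (toℕ-↑ʳ m _) (cong (m +_) (toℕ-↑ʳ 1 v))))))
    (trans (cong toℕ (trans (⊗fun-↑ʳ {m} id (σfun 1 n) (1 ↑ʳ v)) (cong (m ↑ʳ_) (σfun-↑ʳ 1 n v))))
      (trans (toℕ-↑ʳ m (v ↑ˡ 1)) (trans (cong (m +_) (toℕ-↑ˡ v 1)) (sym (trans (toℕ-↑ˡ _ 1) (toℕ-added m n v))))))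

  swap⁻¹S-base-old : ∀ a → fun (swap⁻¹S m n) (base m n a ↑ˡ 1) ≡ base (m + 1) n (a ↑ˡ 1)
  swap⁻¹S-base-old a = cast-conj τ⁻¹-block _ _ (a ↑ˡ (n + 1))
    (trans (toℕ-↑ˡ _ 1) (trans (toℕ-base m n a) (sym (toℕ-↑ˡ a (n + 1)))))
    (trans (cong toℕ (⊗fun-↑ˡ id (σfun n 1) a)) (trans (toℕ-↑ˡ a (1 + n)) (sym (trans (toℕ-base (m + 1) n (a ↑ˡ 1)) (toℕ-↑ˡ a 1)))))

  swap⁻¹S-fresh : fun (swap⁻¹S m n) (fresh (sh m n)) ≡ base (m + 1) n (fresh m)
  swap⁻¹S-fresh = cast-conj τ⁻¹-block _ _ (m ↑ʳ (n ↑ʳ zero))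
    (trans (toℕ-↑ʳ (sh m n) zero) (trans (cong (_+ 0) (sh≡ m n))
      (trans (+-assoc m n 0) (sym (trans (toℕ-↑ʳ m (n ↑ʳ zero)) (cong (m +_) (toℕ-↑ʳ n zero)))))))
    (trans (cong toℕ (trans (⊗fun-↑ʳ {m} id (σfun n 1) (n ↑ʳ zero)) (cong (m ↑ʳ_) (σfun-↑ʳ n 1 zero))))
      (trans (toℕ-↑ʳ m _) (trans (cong (m +_) (toℕ-↑ˡ (zero {0}) n)) (sym (trans (toℕ-base (m + 1) n (fresh m)) (toℕ-↑ʳ m zero))))))

  swap⁻¹S-added : ∀ v → fun (swap⁻¹S m n) (added m n v ↑ˡ 1) ≡ added (m + 1) n v
  swap⁻¹S-added v = cast-conj τ⁻¹-block _ _ (m ↑ʳ (v ↑ˡ 1))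
    (trans (toℕ-↑ˡ _ 1) (trans (toℕ-added m n v) (sym (trans (toℕ-↑ʳ m (v ↑ˡ 1)) (cong (m +_) (toℕ-↑ˡ v 1))))))
    (trans (cong toℕ (trans (⊗fun-↑ʳ {m} id (σfun n 1) (v ↑ˡ 1)) (cong (m ↑ʳ_) (σfun-↑ˡ n 1 v))))
      (trans (toℕ-↑ʳ m (1 ↑ʳ v)) (trans (cong (m +_) (toℕ-↑ʳ 1 v)) (trans (sym (+-assoc m 1 (toℕ v))) (sym (toℕ-added (m + 1) n v))))))

swapS-natural : ∀ {m m'} n (g : Surj m m') z →
                fun (swapS m' n) (fun (shS n (g ⊗S idS {1})) z) ≡ ⊗fun (fun (shS n g)) id (fun (swapS m n) z)
swapS-natural {m} {m'} n g z with shView (m + 1) n z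
... | base′ b with freshView m b
...   | old a =
  trans (cong (fun (swapS m' n)) (trans (shS-base n (g ⊗S idS {1}) (a ↑ˡ 1)) (cong (base (m' + 1) n) (⊗fun-↑ˡ (fun g) id a))))
    (trans (swapS-base-old m' n (fun g a))
      (sym (trans (cong (⊗fun (fun (shS n g)) id) (swapS-base-old m n a))
        (trans (⊗fun-↑ˡ (fun (shS n g)) id (base m n a)) (cong (_↑ˡ 1) (shS-base n g a))))))
...   | new =
  trans (cong (fun (swapS m' n)) (trans (shS-base n (g ⊗S idS {1}) (fresh m)) (cong (base (m' + 1) n) (⊗fun-↑ʳ {m} (fun g) id zero))))
    (trans (swapS-base-fresh m' n)
      (sym (trans (cong (⊗fun (fun (shS n g)) id) (swapS-base-fresh m n)) (⊗fun-↑ʳ {sh m n} (fun (shS n g)) id zero))))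
swapS-natural {m} {m'} n g z | added′ v =
  trans (cong (fun (swapS m' n)) (shS-added n (g ⊗S idS {1}) v))
    (trans (swapS-added m' n v)
      (sym (trans (cong (⊗fun (fun (shS n g)) id) (swapS-added m n v))
        (trans (⊗fun-↑ˡ (fun (shS n g)) id (added m n v)) (cong (_↑ˡ 1) (shS-added n g v))))))

swapS∘swap⁻¹S : ∀ m n z → fun (swapS m n) (fun (swap⁻¹S m n) z) ≡ z
swapS∘swap⁻¹S m n z with freshView (sh m n) z
... | new = trans (cong (fun (swapS m n)) (swap⁻¹S-fresh m n)) (swapS-base-fresh m n)
... | old t with shView m n t
...   | base′ a = trans (cong (fun (swapS m n)) (swap⁻¹S-base-old m n a)) (swapS-base-old m n a)
...   | added′ v = trans (cong (fun (swapS m n)) (swap⁻¹S-added m n v)) (swapS-added m n v)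

swap⁻¹S∘swapS : ∀ m n z → fun (swap⁻¹S m n) (fun (swapS m n) z) ≡ z
swap⁻¹S∘swapS m n z with shView (m + 1) n z
... | added′ v = trans (cong (fun (swap⁻¹S m n)) (swapS-added m n v)) (swap⁻¹S-added m n v)
... | base′ b with freshView m b
...   | old a = trans (cong (fun (swap⁻¹S m n)) (swapS-base-old m n a)) (swap⁻¹S-base-old m n a)
...   | new = trans (cong (fun (swap⁻¹S m n)) (swapS-base-fresh m n)) (swap⁻¹S-fresh m n)

module _ (X : Presheaf) where

  put-≈ : ∀ n {m} {a : ∣ X ∣ (sh m n)} {y : ∣ δ^ n X ∣ m} → X ⊢ a ≈ get X n y → δ^ n X ⊢ put X n a ≈ y
  put-≈ n {a = a} {y} p = get-reflects-≈ X n (subst (λ t → X ⊢ t ≈ get X n y) (sym (get-put X n a)) p)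

  put-cong : ∀ n {m} {a b : ∣ X ∣ (sh m n)} → X ⊢ a ≈ b → δ^ n X ⊢ put X n a ≈ put X n b
  put-cong n {b = b} p = put-≈ n (subst (λ t → X ⊢ _ ≈ t) (sym (get-put X n b)) p)

module _ (X : Presheaf) where

  swapⁿ-cong : ∀ n {m} {x y : ∣ δ (δ^ n X) ∣ m} → δ (δ^ n X) ⊢ x ≈ y → δ^ n (δ X) ⊢ swapⁿ X n x ≈ swapⁿ X n y
  swapⁿ-cong n p = put-cong (δ X) n (act-cong X (λ _ → refl) (get-cong X n p))

  swapⁿ-nat : ∀ n {m m'} (g : Surj m m') (x : ∣ δ (δ^ n X) ∣ m) →
              δ^ n (δ X) ⊢ swapⁿ X n (act (δ (δ^ n X)) g x) ≈ act (δ^ n (δ X)) g (swapⁿ X n x)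
  swapⁿ-nat n {m} {m'} g x = put-≈ (δ X) n (begin
    act X (swapS m' n) (get X n (act (δ^ n X) (g ⊗S idS {1}) x))  ≡⟨ cong (act X (swapS m' n)) (get-act X n (g ⊗S idS {1}) x) ⟩
    act X (swapS m' n) (act X (shS n (g ⊗S idS {1})) (get X n x)) ≈⟨ Fibre.sym X (act-∘ X _ _ _) ⟩
    act X (swapS m' n ∘S shS n (g ⊗S idS {1})) (get X n x)         ≈⟨ act-cong X (swapS-natural n g) (Fibre.refl X) ⟩
    act X ((shS n g ⊗S idS {1}) ∘S swapS m n) (get X n x)          ≈⟨ act-∘ X _ _ _ ⟩
    act X (shS n g ⊗S idS {1}) (act X (swapS m n) (get X n x))     ≡⟨ cong (act (δ X) (shS n g)) (sym (get-put (δ X) n _)) ⟩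
    act (δ X) (shS n g) (get (δ X) n (swapⁿ X n x))                ≡⟨ sym (get-act (δ X) n g (swapⁿ X n x)) ⟩
    get (δ X) n (act (δ^ n (δ X)) g (swapⁿ X n x))                 ∎)
    where open ≈-Reasoning (Ob X _)

  swapⁿ∘swapⁿ⁻¹ : ∀ n {m} (x : ∣ δ^ n (δ X) ∣ m) → δ^ n (δ X) ⊢ swapⁿ X n (swapⁿ⁻¹ X n x) ≈ x
  swapⁿ∘swapⁿ⁻¹ n {m} x = put-≈ (δ X) n (begin
    act X (swapS m n) (get X n (swapⁿ⁻¹ X n x))                       ≡⟨ cong (act X (swapS m n)) (get-put X n _) ⟩
    act X (swapS m n) (act X (swap⁻¹S m n) (get (δ X) n x))           ≈⟨ Fibre.sym X (act-∘ X _ _ _) ⟩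
    act X (swapS m n ∘S swap⁻¹S m n) (get (δ X) n x)                  ≈⟨ act-cong X (swapS∘swap⁻¹S m n) (Fibre.refl X) ⟩
    act X idS (get (δ X) n x)                                         ≈⟨ act-id X _ ⟩
    get (δ X) n x                                                     ∎)
    where open ≈-Reasoning (Ob X _)

  swapⁿ⁻¹∘swapⁿ : ∀ n {m} (x : ∣ δ (δ^ n X) ∣ m) → δ (δ^ n X) ⊢ swapⁿ⁻¹ X n (swapⁿ X n x) ≈ x
  swapⁿ⁻¹∘swapⁿ n {m} x = put-≈ X n (begin
    act X (swap⁻¹S m n) (get (δ X) n (swapⁿ X n x))                   ≡⟨ cong (act X (swap⁻¹S m n)) (get-put (δ X) n _) ⟩
    act X (swap⁻¹S m n) (act X (swapS m n) (get X n x))               ≈⟨ Fibre.sym X (act-∘ X _ _ _) ⟩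
    act X (swap⁻¹S m n ∘S swapS m n) (get X n x)                      ≈⟨ act-cong X (swap⁻¹S∘swapS m n) (Fibre.refl X) ⟩
    act X idS (get X n x)                                             ≈⟨ act-id X _ ⟩
    get X n x                                                         ∎)
    where open ≈-Reasoning (Ob X _)

swapⁿ-map : ∀ {X Y} n (k : Hom X Y) {m} (x : ∣ δ (δ^ n X) ∣ m) →
            δ^ n (δ Y) ⊢ swapⁿ Y n (app (δ^Hom (suc n) k) x) ≈ app (δ^Hom n (δHom k)) (swapⁿ X n x)
swapⁿ-map {X} {Y} n k {m} x = put-≈ (δ Y) n (begin
  act Y (swapS m n) (get Y n (app (δ^Hom n k) x))   ≡⟨ cong (act Y (swapS m n)) (get-app n k x) ⟩
  act Y (swapS m n) (app k (get X n x))             ≈⟨ Fibre.sym Y (app-nat k (swapS m n) (get X n x)) ⟩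
  app k (act X (swapS m n) (get X n x))             ≡⟨ cong (app k) (sym (get-put (δ X) n _)) ⟩
  app k (get (δ X) n (swapⁿ X n x))                 ≡⟨ sym (get-app n (δHom k) (swapⁿ X n x)) ⟩
  get (δ Y) n (app (δ^Hom n (δHom k)) (swapⁿ X n x)) ∎)
  where open ≈-Reasoning (Ob Y _)

-- Functorial actions of Σ and Σ†

module _ {X Y : Presheaf} (k : Hom X Y) where

  TLmap-nat : ∀ ns {m m'} (g : Surj m m') (t : ∣ TL ns X ∣ m) → TL ns Y ⊢ TLmap ns k (act (TL ns X) g t) ≈ act (TL ns Y) g (TLmap ns k t)
  TLmap-nat [] g t = λ _ → refl
  TLmap-nat (n ∷ []) = app-nat (δ^Hom n k)
  TLmap-nat (n ∷ n' ∷ ns) g (el _ _ x y f) = Fibre.refl (TL (n ∷ n' ∷ ns) Y)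

  TLmap-cong : ∀ ns {m} {t t' : ∣ TL ns X ∣ m} → TL ns X ⊢ t ≈ t' → TL ns Y ⊢ TLmap ns k t ≈ TLmap ns k t'
  TLmap-cong [] p = p
  TLmap-cong (n ∷ []) = app-cong (δ^Hom n k)
  TLmap-cong (n ∷ n' ∷ ns) =
    ⊗map-cong (app (δ^Hom n k)) (TLmap (n' ∷ ns) k) (app-cong (δ^Hom n k)) (TLmap-cong (n' ∷ ns)) (app-nat (δ^Hom n k)) (TLmap-nat (n' ∷ ns))

  TLHom : ∀ ns → Hom (TL ns X) (TL ns Y)
  TLHom ns = record { app = TLmap ns k ; app-cong = TLmap-cong ns ; app-nat = TLmap-nat ns }

  ΣHom : ∀ sig → Hom (SigF sig X) (SigF sig Y)
  ΣHom sig = record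
    { app = Σmap sig k
    ; app-cong = λ { (mk {ω} r) → mk (TLmap-cong (ar sig ω) r) }
    ; app-nat = λ { g (ω , t) → mk (TLmap-nat (ar sig ω) g t) } }

TLHom-cong : ∀ ns {X Y} {h k : Hom X Y} → h ≈H k → TLHom h ns ≈H TLHom k ns
TLHom-cong [] e t = λ _ → refl
TLHom-cong (n ∷ []) e = δ^Hom-cong n e
TLHom-cong (n ∷ n' ∷ ns) e (el _ _ x y f) = day-cmp (δ^Hom-cong n e x) (TLHom-cong (n' ∷ ns) e y) (λ _ → refl)

TLHom-∘ : ∀ ns {X Y Z} (h : Hom Y Z) (k : Hom X Y) → TLHom h ns ∘H TLHom k ns ≈H TLHom (h ∘H k) ns
TLHom-∘ [] h k t = λ _ → refl
TLHom-∘ (n ∷ []) {Z = Z} h k x = ≡⇒≈ (δ^ n Z) (δ^Hom-∘ n h k x)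
TLHom-∘ (n ∷ n' ∷ ns) {Z = Z} h k (el _ _ x y f) = day-cmp (≡⇒≈ (δ^ n Z) (δ^Hom-∘ n h k x)) (TLHom-∘ (n' ∷ ns) h k y) (λ _ → refl)

TLHom-id : ∀ ns {X} → TLHom (idH {X}) ns ≈H idH
TLHom-id [] t = λ _ → refl
TLHom-id (n ∷ []) {X} x = ≡⇒≈ (δ^ n X) (δ^Hom-id n x)
TLHom-id (n ∷ n' ∷ ns) {X} (el _ _ x y f) = day-cmp (≡⇒≈ (δ^ n X) (δ^Hom-id n x)) (TLHom-id (n' ∷ ns) y) (λ _ → refl)

module _ (sig : Signature) where

  ΣHom-cong : ∀ {X Y} {h k : Hom X Y} → h ≈H k → ΣHom h sig ≈H ΣHom k sig
  ΣHom-cong e (ω , t) = mk (TLHom-cong (ar sig ω) e t)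

  ΣHom-∘ : ∀ {X Y Z} (h : Hom Y Z) (k : Hom X Y) → ΣHom h sig ∘H ΣHom k sig ≈H ΣHom (h ∘H k) sig
  ΣHom-∘ h k (ω , t) = mk (TLHom-∘ (ar sig ω) h k t)

  ΣHom-id : ∀ {X} → ΣHom (idH {X}) sig ≈H idH
  ΣHom-id (ω , t) = mk (TLHom-id (ar sig ω) t)

ℓHom : ∀ b n {X Y X' Y'} → Hom X X' → Hom Y Y' → Hom (δ^ n (ℓ b X Y)) (δ^ n (ℓ b X' Y'))
ℓHom false n α β = δ^Hom n α
ℓHom true n α β = δ^Hom n β

module _ {X Y X' Y' : Presheaf} (α : Hom X X') (β : Hom Y Y') where

  TFmap₂ : ∀ ns bs {m} → ∣ TF ns bs X Y ∣ m → ∣ TF ns bs X' Y' ∣ m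
  TFmap₂ [] [] z = z
  TFmap₂ (n ∷ []) (b ∷ []) = app (ℓHom b n α β)
  TFmap₂ (n ∷ n' ∷ ns) (b ∷ bs) = ⊗map (app (ℓHom b n α β)) (TFmap₂ (n' ∷ ns) bs)

  TFmap₂-nat : ∀ ns bs {m m'} (g : Surj m m') z → TF ns bs X' Y' ⊢ TFmap₂ ns bs (act (TF ns bs X Y) g z) ≈ act (TF ns bs X' Y') g (TFmap₂ ns bs z)
  TFmap₂-nat [] [] g z = λ _ → refl
  TFmap₂-nat (n ∷ []) (b ∷ []) = app-nat (ℓHom b n α β)
  TFmap₂-nat (n ∷ n' ∷ ns) (b ∷ bs) g (el _ _ x y f) = Fibre.refl (TF (n ∷ n' ∷ ns) (b ∷ bs) X' Y')

  TFmap₂-cong : ∀ ns bs {m} {z z' : ∣ TF ns bs X Y ∣ m} → TF ns bs X Y ⊢ z ≈ z' → TF ns bs X' Y' ⊢ TFmap₂ ns bs z ≈ TFmap₂ ns bs z'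
  TFmap₂-cong [] [] p = p
  TFmap₂-cong (n ∷ []) (b ∷ []) = app-cong (ℓHom b n α β)
  TFmap₂-cong (n ∷ n' ∷ ns) (b ∷ bs) =
    ⊗map-cong (app (ℓHom b n α β)) (TFmap₂ (n' ∷ ns) bs) (app-cong (ℓHom b n α β)) (TFmap₂-cong (n' ∷ ns) bs)
              (app-nat (ℓHom b n α β)) (TFmap₂-nat (n' ∷ ns) bs)

  TF₂ : ∀ ns bs → Hom (TF ns bs X Y) (TF ns bs X' Y')
  TF₂ ns bs = record { app = TFmap₂ ns bs ; app-cong = TFmap₂-cong ns bs ; app-nat = TFmap₂-nat ns bs }

  Σ†₂ : ∀ sig → Hom (SigD sig X Y) (SigD sig X' Y')
  Σ†₂ sig = record
    { app = λ { (ω , j , z) → ω , j , TFmap₂ (ar sig ω) (proj₁ j) z }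
    ; app-cong = λ { (mk {ω} (mk {j} r)) → mk (mk (TFmap₂-cong (ar sig ω) (proj₁ j) r)) }
    ; app-nat = λ { g (ω , j , z) → mk (mk (TFmap₂-nat (ar sig ω) (proj₁ j) g z)) } }

ℓHom-cong : ∀ b n {X Y X' Y'} {α α' : Hom X X'} {β β' : Hom Y Y'} → α ≈H α' → β ≈H β' → ℓHom b n α β ≈H ℓHom b n α' β'
ℓHom-cong false n eα eβ = δ^Hom-cong n eα
ℓHom-cong true n eα eβ = δ^Hom-cong n eβ

ℓHom-∘ : ∀ b n {X Y X' Y' X'' Y''} (α : Hom X' X'') (β : Hom Y' Y'') (α' : Hom X X') (β' : Hom Y Y') {m} x →
         app (ℓHom b n α β) (app (ℓHom b n α' β') {m} x) ≡ app (ℓHom b n (α ∘H α') (β ∘H β')) x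
ℓHom-∘ false n α β α' β' = δ^Hom-∘ n α α'
ℓHom-∘ true n α β α' β' = δ^Hom-∘ n β β'

TF₂-cong : ∀ ns bs {X Y X' Y'} {α α' : Hom X X'} {β β' : Hom Y Y'} → α ≈H α' → β ≈H β' → TF₂ α β ns bs ≈H TF₂ α' β' ns bs
TF₂-cong [] [] eα eβ z = λ _ → refl
TF₂-cong (n ∷ []) (b ∷ []) = ℓHom-cong b n
TF₂-cong (n ∷ n' ∷ ns) (b ∷ bs) eα eβ (el _ _ x y f) =
  day-cmp (ℓHom-cong b n eα eβ x) (TF₂-cong (n' ∷ ns) bs eα eβ y) (λ _ → refl)

TF₂-∘ : ∀ ns bs {X Y X' Y' X'' Y''} (α : Hom X' X'') (β : Hom Y' Y'') (α' : Hom X X') (β' : Hom Y Y') →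
        TF₂ α β ns bs ∘H TF₂ α' β' ns bs ≈H TF₂ (α ∘H α') (β ∘H β') ns bs
TF₂-∘ [] [] α β α' β' z = λ _ → refl
TF₂-∘ (n ∷ []) (b ∷ []) {X'' = X''} {Y''} α β α' β' x = ≡⇒≈ (δ^ n (ℓ b X'' Y'')) (ℓHom-∘ b n α β α' β' x)
TF₂-∘ (n ∷ n' ∷ ns) (b ∷ bs) {X'' = X''} {Y''} α β α' β' (el _ _ x y f) =
  day-cmp (≡⇒≈ (δ^ n (ℓ b X'' Y'')) (ℓHom-∘ b n α β α' β' x)) (TF₂-∘ (n' ∷ ns) bs α β α' β' y) (λ _ → refl)

ℓmap≈ℓHom : ∀ b n {X A B} (h : Hom A B) {m} x → δ^ n (ℓ b X B) ⊢ ℓmap b n {X} h {m} x ≈ app (ℓHom b n idH h) x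
ℓmap≈ℓHom false n {X} h x = ≡⇒≈ (δ^ n X) (sym (δ^Hom-id n x))
ℓmap≈ℓHom true n {B = B} h x = Fibre.refl (δ^ n B)

TFmap≈TF₂ : ∀ ns bs {X A B} (h : Hom A B) {m} z → TF ns bs X B ⊢ TFmap ns bs h {m} z ≈ app (TF₂ idH h ns bs) z
TFmap≈TF₂ [] [] h z = λ _ → refl
TFmap≈TF₂ (n ∷ []) (b ∷ []) h x = ℓmap≈ℓHom b n h x
TFmap≈TF₂ (n ∷ n' ∷ ns) (b ∷ bs) h (el _ _ x y f) = day-cmp (ℓmap≈ℓHom b n h x) (TFmap≈TF₂ (n' ∷ ns) bs h y) (λ _ → refl)

module _ (sig : Signature) where

  Σ†₂-cong : ∀ {X Y X' Y'} {α α' : Hom X X'} {β β' : Hom Y Y'} → α ≈H α' → β ≈H β' → Σ†₂ α β sig ≈H Σ†₂ α' β' sig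
  Σ†₂-cong eα eβ (ω , j , z) = mk (mk (TF₂-cong (ar sig ω) (proj₁ j) eα eβ z))

  Σ†₂-∘ : ∀ {X Y X' Y' X'' Y''} (α : Hom X' X'') (β : Hom Y' Y'') (α' : Hom X X') (β' : Hom Y Y') →
          Σ†₂ α β sig ∘H Σ†₂ α' β' sig ≈H Σ†₂ (α ∘H α') (β ∘H β') sig
  Σ†₂-∘ α β α' β' (ω , j , z) = mk (mk (TF₂-∘ (ar sig ω) (proj₁ j) α β α' β' z))

  Σ†map≈Σ†₂ : ∀ {X A B} (h : Hom A B) {m} (u : ∣ SigD sig X A ∣ m) → SigD sig X B ⊢ Σ†map sig X h u ≈ app (Σ†₂ idH h sig) u
  Σ†map≈Σ†₂ h (ω , j , z) = mk (mk (TFmap≈TF₂ (ar sig ω) (proj₁ j) h z))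

-- swap : δ(ΣX) ≅ Σ†(X, δX)

Swapped : List ℕ → Presheaf → Presheaf
Swapped ns X = ∐ (λ (j : S (length ns)) → TF ns (proj₁ j) X (δ X))

δJ-empty : ∀ {m} → ∣ δ J ∣ m → ⊥
δJ-empty {m} t with surj t (fresh m)
... | () , _

allFalse : (ns : List ℕ) → Vec Bool (length ns)
allFalse [] = []
allFalse (n ∷ ns) = false ∷ allFalse ns

allFalse-zero : (ns : List ℕ) → ¬ T (nz (allFalse ns))
allFalse-zero [] ()
allFalse-zero (n ∷ ns) = allFalse-zero ns

module _ {X Y : Presheaf} where

  fromTL : ∀ ns {m} → ∣ TL ns X ∣ m → ∣ TF ns (allFalse ns) X Y ∣ m
  fromTL [] t = t
  fromTL (n ∷ []) x = x
  fromTL (n ∷ n' ∷ ns) (el m₁ m₂ x y f) = el m₁ m₂ x (fromTL (n' ∷ ns) y) f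

  fromTL-nat : ∀ ns {m m'} (g : Surj m m') t →
               TF ns (allFalse ns) X Y ⊢ fromTL ns (act (TL ns X) g t) ≈ act (TF ns (allFalse ns) X Y) g (fromTL ns t)
  fromTL-nat [] g t = λ _ → refl
  fromTL-nat (n ∷ []) g x = Fibre.refl (δ^ n X)
  fromTL-nat (n ∷ n' ∷ ns) g (el _ _ x y f) = Fibre.refl (TF (n ∷ n' ∷ ns) (allFalse (n ∷ n' ∷ ns)) X Y)

  fromTL-cong : ∀ ns {m} {t t' : ∣ TL ns X ∣ m} → TL ns X ⊢ t ≈ t' → TF ns (allFalse ns) X Y ⊢ fromTL ns t ≈ fromTL ns t'
  fromTL-cong [] p = p
  fromTL-cong (n ∷ []) p = p
  fromTL-cong (n ∷ n' ∷ ns) =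
    ⊗map-cong (λ x → x) (fromTL (n' ∷ ns)) (λ p → p) (fromTL-cong (n' ∷ ns)) (λ g x → Fibre.refl (δ^ n X)) (fromTL-nat (n' ∷ ns))

  allX-fromTL : ∀ ns (q : ¬ T (nz (allFalse ns))) {m} (t : ∣ TL ns X ∣ m) → TL ns X ⊢ allX ns (allFalse ns) {X} {Y} q (fromTL ns t) ≈ t
  allX-fromTL [] q t = λ _ → refl
  allX-fromTL (n ∷ []) q x = Fibre.refl (δ^ n X)
  allX-fromTL (n ∷ n' ∷ ns) q (el _ _ x y f) = day-cmp (Fibre.refl (δ^ n X)) (allX-fromTL (n' ∷ ns) q y) (λ _ → refl)

  -- Equality across index vectors; matching on ≅-at identifies them.
  data TF-≅ (ns : List ℕ) {m : ℕ} : (bs : Vec Bool (length ns)) → ∣ TF ns bs X Y ∣ m →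
                                      (bs' : Vec Bool (length ns)) → ∣ TF ns bs' X Y ∣ m → Set where
    ≅-at : ∀ {bs} {z z' : ∣ TF ns bs X Y ∣ m} → TF ns bs X Y ⊢ z ≈ z' → TF-≅ ns bs z bs z'

  fromTL-allX : ∀ ns bs (q : ¬ T (nz bs)) {m} (z : ∣ TF ns bs X Y ∣ m) → TF-≅ ns (allFalse ns) (fromTL ns (allX ns bs {X} {Y} q z)) bs z
  fromTL-allX [] [] q z = ≅-at (λ _ → refl)
  fromTL-allX (n ∷ []) (false ∷ []) q x = ≅-at (Fibre.refl (δ^ n X))
  fromTL-allX (n ∷ []) (true ∷ []) q x = ⊥-elim (q tt)
  fromTL-allX (n ∷ n' ∷ ns) (true ∷ bs) q z = ⊥-elim (q tt)
  fromTL-allX (n ∷ n' ∷ ns) (false ∷ bs) q (el m₁ m₂ x y f) with fromTL-allX (n' ∷ ns) bs q y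
  ... | ≅-at r = ≅-at (day-cmp {δ^ n X} {TF (n' ∷ ns) bs X Y} (Fibre.refl (δ^ n X)) r (λ _ → refl))

∨-introʳ : ∀ b {c} → T c → T (b ∨ c)
∨-introʳ true _ = tt
∨-introʳ false p = p

swapᵇ : ∀ b n X {k} → ∣ δᵇ b (δ^ n X) ∣ k → ∣ δ^ n (ℓ b X (δ X)) ∣ k
swapᵇ true n X = swapⁿ X n
swapᵇ false n X x = x

cons : ∀ b n n' ns X {k₁ k₂ m} → ∣ δ^ n (ℓ b X (δ X)) ∣ k₁ → Surj (k₁ + k₂) m →
       ∣ Swapped (n' ∷ ns) X ∣ k₂ → ∣ Swapped (n ∷ n' ∷ ns) X ∣ m
cons b n n' ns X x g ((bs , p) , z) = ((b ∷ bs) , ∨-introʳ b p) , el _ _ x z g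

swapLeibniz : ∀ n n' ns X → (∀ {k} → ∣ δ (TL (n' ∷ ns) X) ∣ k → ∣ Swapped (n' ∷ ns) X ∣ k) →
              ∀ {m} → Leibniz (δ^ n X) (TL (n' ∷ ns) X) m → ∣ Swapped (n ∷ n' ∷ ns) X ∣ m
swapLeibniz n n' ns X rec (leibniz b true _ (el _ _ x y g)) = cons b n n' ns X (swapᵇ b n X x) g (rec y)
swapLeibniz n n' ns X rec (leibniz true false _ (el k₁ k₂ x y g)) =
  ((true ∷ allFalse (n' ∷ ns)) , tt) , el k₁ k₂ (swapⁿ X n x) (fromTL (n' ∷ ns) y) g
swapLeibniz n n' ns X rec (leibniz false false () _)

swapTL : ∀ ns X {k} → ∣ δ (TL ns X) ∣ k → ∣ Swapped ns X ∣ k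
swapTL [] X t = ⊥-elim (δJ-empty t)
swapTL (n ∷ []) X x = ((true ∷ []) , tt) , swapⁿ X n x
swapTL (n ∷ n' ∷ ns) X t = swapLeibniz n n' ns X (swapTL (n' ∷ ns) X) (split t)

module _ (b : Bool) (n n' : ℕ) (ns : List ℕ) (X : Presheaf) where

  private
    L = δ^ n (ℓ b X (δ X))

  cons-cong : ∀ {k₁ k₂ m} {x x' : ∣ L ∣ k₁} {g g' : Surj (k₁ + k₂) m} {s s' : ∣ Swapped (n' ∷ ns) X ∣ k₂} →
              L ⊢ x ≈ x' → g ≗S g' → Swapped (n' ∷ ns) X ⊢ s ≈ s' →
              Swapped (n ∷ n' ∷ ns) X ⊢ cons b n n' ns X x g s ≈ cons b n n' ns X x' g' s'
  cons-cong px pg (mk r) = mk (day-cmp px r pg)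

  cons-coend : ∀ {k₁ k₂ k₁' k₂' m} (g₁ : Surj k₁ k₁') (g₂ : Surj k₂ k₂') (x : ∣ L ∣ k₁) (g : Surj (k₁' + k₂') m) s →
               Swapped (n ∷ n' ∷ ns) X ⊢ cons b n n' ns X (act L g₁ x) g (act (Swapped (n' ∷ ns) X) g₂ s)
                                         ≈ cons b n n' ns X x (g ∘S (g₁ ⊗S g₂)) s
  cons-coend g₁ g₂ x g ((bs , p) , z) = mk (day-step (coend g₁ g₂ x z g))

swapᵇ-cong : ∀ b n X {k} {x x' : ∣ δᵇ b (δ^ n X) ∣ k} → δᵇ b (δ^ n X) ⊢ x ≈ x' →
             δ^ n (ℓ b X (δ X)) ⊢ swapᵇ b n X x ≈ swapᵇ b n X x'
swapᵇ-cong true n X = swapⁿ-cong X n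
swapᵇ-cong false n X p = p

swapᵇ-nat : ∀ b n X {k k'} (g : Surj k k') (x : ∣ δᵇ b (δ^ n X) ∣ k) →
            δ^ n (ℓ b X (δ X)) ⊢ swapᵇ b n X (act (δᵇ b (δ^ n X)) g x) ≈ act (δ^ n (ℓ b X (δ X))) g (swapᵇ b n X x)
swapᵇ-nat true n X = swapⁿ-nat X n
swapᵇ-nat false n X g x = Fibre.refl (δ^ n X)

module SwapLeibniz (n n' : ℕ) (ns : List ℕ) (X : Presheaf)
  (rec : ∀ {k} → ∣ δ (TL (n' ∷ ns) X) ∣ k → ∣ Swapped (n' ∷ ns) X ∣ k)
  (rec-cong : ∀ {k} {t t' : ∣ δ (TL (n' ∷ ns) X) ∣ k} → δ (TL (n' ∷ ns) X) ⊢ t ≈ t' → Swapped (n' ∷ ns) X ⊢ rec t ≈ rec t')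
  (rec-nat : ∀ {k k'} (g : Surj k k') (t : ∣ δ (TL (n' ∷ ns) X) ∣ k) →
             Swapped (n' ∷ ns) X ⊢ rec (act (δ (TL (n' ∷ ns) X)) g t) ≈ act (Swapped (n' ∷ ns) X) g (rec t)) where

  private
    A = δ^ n X
    B = TL (n' ∷ ns) X
    Sw = Swapped (n ∷ n' ∷ ns) X
    swap : ∀ {m} → Leibniz A B m → ∣ Sw ∣ m
    swap = swapLeibniz n n' ns X rec

  swapLeibniz-step : ∀ b₁ b₂ .(p : T (b₁ ∨ b₂)) {m} {d d' : DayEl (δᵇ b₁ A) (δᵇ b₂ B) m} → DayStep (δᵇ b₁ A) (δᵇ b₂ B) d d' →
                     Sw ⊢ swap (leibniz b₁ b₂ p d) ≈ swap (leibniz b₁ b₂ p d')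
  swapLeibniz-step b₁ true p (cmp px py pg) = cons-cong b₁ n n' ns X (swapᵇ-cong b₁ n X px) pg (rec-cong py)
  swapLeibniz-step b₁ true p (coend g₁ g₂ x y g) =
    Fibre.trans Sw (cons-cong b₁ n n' ns X (swapᵇ-nat b₁ n X g₁ x) (λ _ → refl) (rec-nat g₂ y))
      (cons-coend b₁ n n' ns X g₁ g₂ (swapᵇ b₁ n X x) g (rec y))
  swapLeibniz-step true false p (cmp px py pg) = mk (day-cmp (swapⁿ-cong X n px) (fromTL-cong (n' ∷ ns) py) pg)
  swapLeibniz-step true false p (coend g₁ g₂ x y g) =
    mk (Fibre.trans (δ^ n (δ X) ⊗̂ TF (n' ∷ ns) (allFalse (n' ∷ ns)) X (δ X))
      (day-cmp (swapⁿ-nat X n g₁ x) (fromTL-nat (n' ∷ ns) g₂ y) (λ _ → refl))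
      (day-step (coend g₁ g₂ (swapⁿ X n x) (fromTL (n' ∷ ns) y) g)))
  swapLeibniz-step false false () s

  swapLeibniz-cong : ∀ {m} {h h' : Leibniz A B m} → Leibniz≈ h h' → Sw ⊢ swap h ≈ swap h'
  swapLeibniz-cong (leibniz≈ {b₁} {b₂} {p} r) =
    gfold (Setoid.isEquivalence (Ob Sw _)) (λ d → swap (leibniz b₁ b₂ p d)) (swapLeibniz-step b₁ b₂ p) r

  swapLeibniz-nat : ∀ {m m'} (g : Surj m m') (h : Leibniz A B m) → Sw ⊢ swap (leibnizAct g h) ≈ act Sw g (swap h)
  swapLeibniz-nat g (leibniz b₁ true p (el _ _ x y f)) with rec y
  ... | (bs , q) , z = Fibre.refl Sw
  swapLeibniz-nat g (leibniz true false p (el _ _ x y f)) = Fibre.refl Sw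
  swapLeibniz-nat g (leibniz false false () d)

mutual
  swapTL-cong : ∀ ns X {k} {t t' : ∣ δ (TL ns X) ∣ k} → δ (TL ns X) ⊢ t ≈ t' → Swapped ns X ⊢ swapTL ns X t ≈ swapTL ns X t'
  swapTL-cong [] X {t = t} p = ⊥-elim (δJ-empty t)
  swapTL-cong (n ∷ []) X p = mk (swapⁿ-cong X n p)
  swapTL-cong (n ∷ n' ∷ ns) X p =
    SwapLeibniz.swapLeibniz-cong n n' ns X (swapTL (n' ∷ ns) X) (swapTL-cong (n' ∷ ns) X) (swapTL-nat (n' ∷ ns) X) (split-cong p)

  swapTL-nat : ∀ ns X {k k'} (g : Surj k k') (t : ∣ δ (TL ns X) ∣ k) →
               Swapped ns X ⊢ swapTL ns X (act (δ (TL ns X)) g t) ≈ act (Swapped ns X) g (swapTL ns X t)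
  swapTL-nat [] X g t = ⊥-elim (δJ-empty t)
  swapTL-nat (n ∷ []) X g t = mk (swapⁿ-nat X n g t)
  swapTL-nat (n ∷ n' ∷ ns) X g t =
    Fibre.trans (Swapped (n ∷ n' ∷ ns) X) (swapLeibniz-cong (split-nat g t)) (swapLeibniz-nat g (split t))
    where open SwapLeibniz n n' ns X (swapTL (n' ∷ ns) X) (swapTL-cong (n' ∷ ns) X) (swapTL-nat (n' ∷ ns) X)

unswapped : ∀ ns X {m} → ∣ Swapped ns X ∣ m → ∣ δ (TL ns X) ∣ m
unswapped ns X ((bs , p) , z) = unswap ns bs X p z

unswapped-swapLeibniz : ∀ n n' ns X (rec : ∀ {k} → ∣ δ (TL (n' ∷ ns) X) ∣ k → ∣ Swapped (n' ∷ ns) X ∣ k) →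
                        (∀ {k} (t : ∣ δ (TL (n' ∷ ns) X) ∣ k) → δ (TL (n' ∷ ns) X) ⊢ unswapped (n' ∷ ns) X (rec t) ≈ t) →
                        ∀ {m} (h : Leibniz (δ^ n X) (TL (n' ∷ ns) X) m) →
                        δ (TL (n ∷ n' ∷ ns) X) ⊢ unswapped (n ∷ n' ∷ ns) X (swapLeibniz n n' ns X rec h) ≈ merge h
unswapped-swapLeibniz n n' ns X rec inv (leibniz false true _ (el _ _ x y g)) with rec y | inv y
... | (bs , p) , z | z≈y = day-cmp (Fibre.refl (δ^ n X)) z≈y (λ _ → refl)
unswapped-swapLeibniz n n' ns X rec inv (leibniz true true _ (el _ _ x y g)) with rec y | inv y
... | (bs , p) , z | z≈y with T? (nz bs)
...   | yes q rewrite T-irrelevant q p = day-cmp (swapⁿ⁻¹∘swapⁿ X n x) z≈y (λ _ → refl)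
...   | no q = ⊥-elim (q p)
unswapped-swapLeibniz n n' ns X rec inv (leibniz true false _ (el _ _ x y g)) with T? (nz (allFalse (n' ∷ ns)))
... | yes q = ⊥-elim (allFalse-zero (n' ∷ ns) q)
... | no q = day-cmp (swapⁿ⁻¹∘swapⁿ X n x) (allX-fromTL (n' ∷ ns) q y) (λ _ → refl)
unswapped-swapLeibniz n n' ns X rec inv (leibniz false false () _)

unswapped∘swapTL : ∀ ns X {k} (t : ∣ δ (TL ns X) ∣ k) → δ (TL ns X) ⊢ unswapped ns X (swapTL ns X t) ≈ t
unswapped∘swapTL [] X t = ⊥-elim (δJ-empty t)
unswapped∘swapTL (n ∷ []) X x = swapⁿ⁻¹∘swapⁿ X n x
unswapped∘swapTL (n ∷ n' ∷ ns) X t =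
  Fibre.trans (δ (TL (n ∷ n' ∷ ns) X))
    (unswapped-swapLeibniz n n' ns X (swapTL (n' ∷ ns) X) (unswapped∘swapTL (n' ∷ ns) X) (split t)) (merge-split t)

swapTL-merge : ∀ n n' ns X {m} (h : Leibniz (δ^ n X) (TL (n' ∷ ns) X) m) →
               Swapped (n ∷ n' ∷ ns) X ⊢ swapTL (n ∷ n' ∷ ns) X (merge h) ≈ swapLeibniz n n' ns X (swapTL (n' ∷ ns) X) h
swapTL-merge n n' ns X h =
  SwapLeibniz.swapLeibniz-cong n n' ns X (swapTL (n' ∷ ns) X) (swapTL-cong (n' ∷ ns) X) (swapTL-nat (n' ∷ ns) X) (split-merge h)

swapTL-unswap : ∀ ns X bs (p : T (nz bs)) {m} (z : ∣ TF ns bs X (δ X) ∣ m) →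
                Swapped ns X ⊢ swapTL ns X (unswap ns bs X p z) ≈ ((bs , p) , z)
swapTL-unswap [] X [] () z
swapTL-unswap (n ∷ []) X (true ∷ []) p x = mk (swapⁿ∘swapⁿ⁻¹ X n x)
swapTL-unswap (n ∷ []) X (false ∷ []) () x
swapTL-unswap (n ∷ n' ∷ ns) X (true ∷ bs) p (el k₁ k₂ x y f) with T? (nz bs)
... | yes q = Fibre.trans (Swapped (n ∷ n' ∷ ns) X)
      (swapTL-merge n n' ns X (leibniz true true tt (el k₁ k₂ (swapⁿ⁻¹ X n x) (unswap (n' ∷ ns) bs X q y) f)))
      (cons-cong true n n' ns X (swapⁿ∘swapⁿ⁻¹ X n x) (λ _ → refl) (swapTL-unswap (n' ∷ ns) X bs q y))
... | no q with fromTL-allX {X} {δ X} (n' ∷ ns) bs q y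
...   | ≅-at r = Fibre.trans (Swapped (n ∷ n' ∷ ns) X)
      (swapTL-merge n n' ns X (leibniz true false tt (el k₁ k₂ (swapⁿ⁻¹ X n x) (allX (n' ∷ ns) bs q y) f)))
      (mk (day-cmp (swapⁿ∘swapⁿ⁻¹ X n x) r (λ _ → refl)))
swapTL-unswap (n ∷ n' ∷ ns) X (false ∷ bs) p (el k₁ k₂ x y f) = Fibre.trans (Swapped (n ∷ n' ∷ ns) X)
  (swapTL-merge n n' ns X (leibniz false true tt (el k₁ k₂ x (unswap (n' ∷ ns) bs X p y) f)))
  (cons-cong false n n' ns X (Fibre.refl (δ^ n X)) (λ _ → refl) (swapTL-unswap (n' ∷ ns) X bs p y))

module _ {X Y : Presheaf} (k : Hom X Y) where

  swappedMap : ∀ ns {m} → ∣ Swapped ns X ∣ m → ∣ Swapped ns Y ∣ m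
  swappedMap ns (j , z) = j , app (TF₂ k (δHom k) ns (proj₁ j)) z

  fromTL-map : ∀ ns {m} (t : ∣ TL ns X ∣ m) →
               TF ns (allFalse ns) Y (δ Y) ⊢ fromTL ns (TLmap ns k t) ≈ app (TF₂ k (δHom k) ns (allFalse ns)) (fromTL ns t)
  fromTL-map [] t = λ _ → refl
  fromTL-map (n ∷ []) x = Fibre.refl (δ^ n Y)
  fromTL-map (n ∷ n' ∷ ns) (el _ _ x y f) = day-cmp (Fibre.refl (δ^ n Y)) (fromTL-map (n' ∷ ns) y) (λ _ → refl)

  swapᵇ-map : ∀ b n {m} (x : ∣ δᵇ b (δ^ n X) ∣ m) →
              δ^ n (ℓ b Y (δ Y)) ⊢ swapᵇ b n Y (app (δᵇHom b (δ^Hom n k)) x) ≈ app (ℓHom b n k (δHom k)) (swapᵇ b n X x)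
  swapᵇ-map true n x = swapⁿ-map n k x
  swapᵇ-map false n x = Fibre.refl (δ^ n Y)

  swapLeibniz-map : ∀ n n' ns (recX : ∀ {j} → ∣ δ (TL (n' ∷ ns) X) ∣ j → ∣ Swapped (n' ∷ ns) X ∣ j)
                    (recY : ∀ {j} → ∣ δ (TL (n' ∷ ns) Y) ∣ j → ∣ Swapped (n' ∷ ns) Y ∣ j) →
                    (∀ {j} (t : ∣ δ (TL (n' ∷ ns) X) ∣ j) → Swapped (n' ∷ ns) Y ⊢ recY (TLmap (n' ∷ ns) k t) ≈ swappedMap (n' ∷ ns) (recX t)) →
                    ∀ {m} (h : Leibniz (δ^ n X) (TL (n' ∷ ns) X) m) →
                    Swapped (n ∷ n' ∷ ns) Y ⊢ swapLeibniz n n' ns Y recY (leibnizMap (δ^Hom n k) (TLHom k (n' ∷ ns)) h)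
                                              ≈ swappedMap (n ∷ n' ∷ ns) (swapLeibniz n n' ns X recX h)
  swapLeibniz-map n n' ns recX recY rec-map (leibniz b true _ (el _ _ x y g)) with recX y | rec-map y
  ... | (bs , p) , z | r = cons-cong b n n' ns Y (swapᵇ-map b n x) (λ _ → refl) r
  swapLeibniz-map n n' ns recX recY rec-map (leibniz true false _ (el _ _ x y g)) =
    mk (day-cmp (swapⁿ-map n k x) (fromTL-map (n' ∷ ns) y) (λ _ → refl))
  swapLeibniz-map n n' ns recX recY rec-map (leibniz false false () _)

  swapTL-map : ∀ ns {m} (t : ∣ δ (TL ns X) ∣ m) → Swapped ns Y ⊢ swapTL ns Y (TLmap ns k t) ≈ swappedMap ns (swapTL ns X t)
  swapTL-map [] t = ⊥-elim (δJ-empty t)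
  swapTL-map (n ∷ []) x = mk (swapⁿ-map n k x)
  swapTL-map (n ∷ n' ∷ ns) t = Fibre.trans (Swapped (n ∷ n' ∷ ns) Y)
    (SwapLeibniz.swapLeibniz-cong n n' ns Y (swapTL (n' ∷ ns) Y) (swapTL-cong (n' ∷ ns) Y) (swapTL-nat (n' ∷ ns) Y)
      (split-map (δ^Hom n k) (TLHom k (n' ∷ ns)) t))
    (swapLeibniz-map n n' ns (swapTL (n' ∷ ns) X) (swapTL (n' ∷ ns) Y) (swapTL-map (n' ∷ ns)) (split t))

module _ (sig : Signature) where

  swapΣ : ∀ X → Hom (δ (SigF sig X)) (SigD sig X (δ X))
  swapΣ X = record
    { app = λ { (ω , t) → ω , swapTL (ar sig ω) X t }
    ; app-cong = λ { (mk {ω} r) → mk (swapTL-cong (ar sig ω) X r) }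
    ; app-nat = λ { g (ω , t) → mk (swapTL-nat (ar sig ω) X g t) } }

  swapΣ-natural : ∀ {X Y} (k : Hom X Y) → swapΣ Y ∘H δHom (ΣHom k sig) ≈H Σ†₂ k (δHom k) sig ∘H swapΣ X
  swapΣ-natural k (ω , t) = mk (swapTL-map k (ar sig ω) t)

  swapΣ∘swap⁻¹ : ∀ X {m} (u : ∣ SigD sig X (δ X) ∣ m) → SigD sig X (δ X) ⊢ app (swapΣ X) (swap⁻¹ sig X u) ≈ u
  swapΣ∘swap⁻¹ X (ω , (bs , p) , z) = mk (swapTL-unswap (ar sig ω) X bs p z)

  swap⁻¹∘swapΣ : ∀ X {m} (t : ∣ δ (SigF sig X) ∣ m) → δ (SigF sig X) ⊢ swap⁻¹ sig X (app (swapΣ X) t) ≈ t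
  swap⁻¹∘swapΣ X (ω , t) = mk (unswapped∘swapTL (ar sig ω) X t)

-- The right adjoint of δ and initiality of δ(TV)

infixr 2 _×ₚ_
_×ₚ_ : Presheaf → Presheaf → Presheaf
A ×ₚ B = record
  { Ob = λ n → record
      { Carrier = ∣ A ∣ n × ∣ B ∣ n
      ; _≈_ = λ p q → (A ⊢ proj₁ p ≈ proj₁ q) × (B ⊢ proj₂ p ≈ proj₂ q)
      ; isEquivalence = record
          { refl = Fibre.refl A , Fibre.refl B
          ; sym = λ p → Fibre.sym A (proj₁ p) , Fibre.sym B (proj₂ p)
          ; trans = λ p q → Fibre.trans A (proj₁ p) (proj₁ q) , Fibre.trans B (proj₂ p) (proj₂ q) } }
  ; act = λ f p → act A f (proj₁ p) , act B f (proj₂ p)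
  ; act-cong = λ p q → act-cong A p (proj₁ q) , act-cong B p (proj₂ q)
  ; act-id = λ p → act-id A (proj₁ p) , act-id B (proj₂ p)
  ; act-∘ = λ g f p → act-∘ A g f (proj₁ p) , act-∘ B g f (proj₂ p)
  }

π₁H : ∀ {A B} → Hom (A ×ₚ B) A
π₁H {A} = record { app = proj₁ ; app-cong = proj₁ ; app-nat = λ f p → Fibre.refl A }

π₂H : ∀ {A B} → Hom (A ×ₚ B) B
π₂H {B = B} = record { app = proj₂ ; app-cong = proj₂ ; app-nat = λ f p → Fibre.refl B }

⟨_,_⟩H : ∀ {C A B} → Hom C A → Hom C B → Hom C (A ×ₚ B)
⟨ f , g ⟩H = record
  { app = λ x → app f x , app g x
  ; app-cong = λ p → app-cong f p , app-cong g p
  ; app-nat = λ h x → app-nat f h x , app-nat g h x }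

[_,_]H : ∀ {A B C} → Hom A C → Hom B C → Hom (A ⊕ B) C
[ f , g ]H = record
  { app = λ { (inj₁ a) → app f a ; (inj₂ b) → app g b }
  ; app-cong = λ { (PW.inj₁ p) → app-cong f p ; (PW.inj₂ p) → app-cong g p }
  ; app-nat = λ { h (inj₁ a) → app-nat f h a ; h (inj₂ b) → app-nat g h b } }

module _ (A : Presheaf) where

  -- (Ran A)(n) = Nat(𝕊(n, − + 1), A).
  record RanEl (n : ℕ) : Set where
    field
      fam : ∀ m → Surj n (m + 1) → ∣ A ∣ m
      fam-cong : ∀ m {s s' : Surj n (m + 1)} → s ≗S s' → A ⊢ fam m s ≈ fam m s'
      fam-nat : ∀ m m' (g : Surj m m') (s : Surj n (m + 1)) → A ⊢ fam m' ((g ⊗S idS {1}) ∘S s) ≈ act A g (fam m s)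
  open RanEl public

  Ran : Presheaf
  Ran = record
    { Ob = λ n → record
        { Carrier = RanEl n
        ; _≈_ = λ α β → ∀ m s → A ⊢ fam α m s ≈ fam β m s
        ; isEquivalence = record
            { refl = λ m s → Fibre.refl A
            ; sym = λ p m s → Fibre.sym A (p m s)
            ; trans = λ p q m s → Fibre.trans A (p m s) (q m s) } }
    ; act = λ f α → record
        { fam = λ m s → fam α m (s ∘S f)
        ; fam-cong = λ m p → fam-cong α m (λ z → p (fun f z))
        ; fam-nat = λ m m' g s → Fibre.trans A (fam-cong α m' (λ _ → refl)) (fam-nat α m m' g (s ∘S f)) }
    ; act-cong = λ {_} {_} {f} {g} {α} {β} p q m s → Fibre.trans A (fam-cong α m (λ z → cong (fun s) (p z))) (q m (s ∘S g))
    ; act-id = λ α m s → fam-cong α m (λ _ → refl)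
    ; act-∘ = λ g f α m s → fam-cong α m (λ _ → refl)
    }

  counit : Hom (δ Ran) A
  counit = record
    { app = λ {m} α → fam α m idS
    ; app-cong = λ {m} p → p m idS
    ; app-nat = λ {m} {m'} g α → Fibre.trans A (fam-cong α m' (λ _ → refl)) (fam-nat α m m' g idS) }

  transpose : ∀ {X} → Hom (δ X) A → Hom X Ran
  transpose {X} h = record
    { app = λ x → record
        { fam = λ m s → app h (act X s x)
        ; fam-cong = λ m p → app-cong h (act-cong X p (Fibre.refl X))
        ; fam-nat = λ m m' g s → Fibre.trans A (app-cong h (act-∘ X (g ⊗S idS {1}) s x)) (app-nat h g (act X s x)) }
    ; app-cong = λ p m s → app-cong h (act-cong X (λ _ → refl) p)
    ; app-nat = λ f x m s → app-cong h (Fibre.sym X (act-∘ X s f x)) }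

  counit-transpose : ∀ {X} (h : Hom (δ X) A) → counit ∘H δHom (transpose {X} h) ≈H h
  counit-transpose {X} h x = app-cong h (act-id X x)

module Derivative (sig : Signature) (TV : Presheaf) (η : Hom V TV) (φ : Hom (SigF sig TV) TV)
                  (init : IsInitial (VΣ sig) TV (algStr sig TV η φ)) where

  initialAlgebra : Hom (V ⊕ SigF sig TV) TV
  initialAlgebra = [ η , φ ]H

  module _ (A : Presheaf) (a : Hom (F₀ (δVΣ† sig TV) A) A) where

    P : Presheaf
    P = TV ×ₚ Ran A

    π₁P : Hom P TV
    π₁P = π₁H {TV} {Ran A}

    evalRan : Hom (δ P) A
    evalRan = counit A ∘H δHom (π₂H {TV} {Ran A})

    descend : Hom (δ (SigF sig P)) (SigD sig TV A)
    descend = Σ†₂ π₁P evalRan sig ∘H swapΣ sig P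

    -- The first component rebuilds TV; the second computes the transpose of the map δ(TV) → A.
    algebraP : Hom (V ⊕ SigF sig P) P
    algebraP = ⟨ [ η , φ ∘H ΣHom π₁P sig ]H , [ transpose A (a ∘H inj₁H) , transpose A (a ∘H inj₂H ∘H descend) ]H ⟩H

    descend-natural : ∀ (q : Hom TV P) {m} (w : ∣ δ (SigF sig TV) ∣ m) →
                      SigD sig TV A ⊢ app descend (Σmap sig q w) ≈ app (Σ†₂ (π₁P ∘H q) (evalRan ∘H δHom q) sig) (app (swapΣ sig TV) w)
    descend-natural q w = begin
      app (Σ†₂ π₁P evalRan sig) (app (swapΣ sig P) (Σmap sig q w))                         ≈⟨ app-cong (Σ†₂ π₁P evalRan sig) (swapΣ-natural sig q w) ⟩
      app (Σ†₂ π₁P evalRan sig) (app (Σ†₂ q (δHom q) sig) (app (swapΣ sig TV) w))           ≈⟨ Σ†₂-∘ sig π₁P evalRan q (δHom q) _ ⟩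
      app (Σ†₂ (π₁P ∘H q) (evalRan ∘H δHom q) sig) (app (swapΣ sig TV) w)                   ∎
      where open ≈-Reasoning (Ob (SigD sig TV A) _)

    fold : Hom TV P
    fold = proj₁ (proj₁ (init P algebraP))

    fold-alg : IsAlgHom (VΣ sig) TV (algStr sig TV η φ) P algebraP fold
    fold-alg = proj₂ (proj₁ (init P algebraP))

    π₁∘fold≈id : π₁P ∘H fold ≈H idH
    π₁∘fold≈id = proj₂ (init TV initialAlgebra) (π₁P ∘H fold) idH π₁∘fold-alg id-alg
      where
      π₁∘fold-alg : IsAlgHom (VΣ sig) TV (algStr sig TV η φ) TV initialAlgebra (π₁P ∘H fold)
      π₁∘fold-alg (inj₁ v) = proj₁ (fold-alg (inj₁ v))
      π₁∘fold-alg (inj₂ t) = Fibre.trans TV (proj₁ (fold-alg (inj₂ t))) (app-cong φ (ΣHom-∘ sig π₁P fold t))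
      id-alg : IsAlgHom (VΣ sig) TV (algStr sig TV η φ) TV initialAlgebra idH
      id-alg (inj₁ v) = Fibre.refl TV
      id-alg (inj₂ t) = app-cong φ (Fibre.sym (SigF sig TV) (ΣHom-id sig t))

    fromδTV : Hom (δ TV) A
    fromδTV = evalRan ∘H δHom fold

    fromδTV-alg : IsAlgHom (δVΣ† sig TV) (δ TV) (derivStr sig TV η φ) A a fromδTV
    fromδTV-alg {m} (inj₁ v) = Fibre.trans A (proj₂ (fold-alg (inj₁ v)) m idS) (app-cong a (PW.inj₁ (λ _ → refl)))
    fromδTV-alg {m} (inj₂ u) = Fibre.trans A (proj₂ (fold-alg (inj₂ w)) m idS) (app-cong a (PW.inj₂ (begin
      app descend (act (SigF sig P) idS (Σmap sig fold w))                ≈⟨ app-cong descend (act-id (SigF sig P) _) ⟩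
      app descend (Σmap sig fold w)                                        ≈⟨ descend-natural fold w ⟩
      app (Σ†₂ (π₁P ∘H fold) fromδTV sig) (app (swapΣ sig TV) w)          ≈⟨ Σ†₂-cong sig π₁∘fold≈id (λ x → Fibre.refl A) _ ⟩
      app (Σ†₂ idH fromδTV sig) (app (swapΣ sig TV) w)                    ≈⟨ app-cong (Σ†₂ idH fromδTV sig) (swapΣ∘swap⁻¹ sig TV u) ⟩
      app (Σ†₂ idH fromδTV sig) u                                          ≈⟨ Fibre.sym (SigD sig TV A) (Σ†map≈Σ†₂ sig fromδTV u) ⟩
      Σ†map sig TV fromδTV u                                               ∎)))
      where
      w = swap⁻¹ sig TV u
      open ≈-Reasoning (Ob (SigD sig TV A) m)

    module _ (h : Hom (δ TV) A) (h-alg : IsAlgHom (δVΣ† sig TV) (δ TV) (derivStr sig TV η φ) A a h) where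

      withTranspose : Hom TV P
      withTranspose = ⟨ idH , transpose A h ⟩H

      descend-withTranspose : ∀ {m} (w : ∣ δ (SigF sig TV) ∣ m) →
                              SigD sig TV A ⊢ app descend (Σmap sig withTranspose w) ≈ Σ†map sig TV h (app (swapΣ sig TV) w)
      descend-withTranspose w = begin
        app descend (Σmap sig withTranspose w)                                          ≈⟨ descend-natural withTranspose w ⟩
        app (Σ†₂ (π₁P ∘H withTranspose) (evalRan ∘H δHom withTranspose) sig) (app (swapΣ sig TV) w)
          ≈⟨ Σ†₂-cong sig (λ x → Fibre.refl TV) (counit-transpose A {TV} h) _ ⟩
        app (Σ†₂ idH h sig) (app (swapΣ sig TV) w)                                      ≈⟨ Fibre.sym (SigD sig TV A) (Σ†map≈Σ†₂ sig h _) ⟩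
        Σ†map sig TV h (app (swapΣ sig TV) w)                                            ∎
        where open ≈-Reasoning (Ob (SigD sig TV A) _)

      transpose-φ : ∀ {n} (t : ∣ SigF sig TV ∣ n) m (s : Surj n (m + 1)) →
                    A ⊢ app h (act TV s (app φ t)) ≈ app a (inj₂ (app descend (act (SigF sig P) s (Σmap sig withTranspose t))))
      transpose-φ t m s = begin
        app h (act TV s (app φ t))                                ≈⟨ app-cong h (Fibre.sym TV (app-nat φ s t)) ⟩
        app h (app φ w)                                           ≈⟨ app-cong h (app-cong φ (Fibre.sym (δ (SigF sig TV)) (swap⁻¹∘swapΣ sig TV w))) ⟩
        app h (app φ (swap⁻¹ sig TV (app (swapΣ sig TV) w)))      ≈⟨ h-alg (inj₂ (app (swapΣ sig TV) w)) ⟩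
        app a (inj₂ (Σ†map sig TV h (app (swapΣ sig TV) w)))
          ≈⟨ app-cong a (PW.inj₂ (Fibre.trans (SigD sig TV A) (Fibre.sym (SigD sig TV A) (descend-withTranspose w))
                                   (app-cong descend (app-nat (ΣHom withTranspose sig) s t)))) ⟩
        app a (inj₂ (app descend (act (SigF sig P) s (Σmap sig withTranspose t))))  ∎
        where
        w = act (SigF sig TV) s t
        open ≈-Reasoning (Ob A m)

      withTranspose-alg : IsAlgHom (VΣ sig) TV (algStr sig TV η φ) P algebraP withTranspose
      withTranspose-alg (inj₁ v) =
        Fibre.refl TV , λ m s → Fibre.trans A (app-cong h (Fibre.sym TV (app-nat η s v))) (h-alg (inj₁ (s ∘S v)))
      withTranspose-alg (inj₂ t) =
        app-cong φ (Fibre.sym (SigF sig TV) (Fibre.trans (SigF sig TV) (ΣHom-∘ sig π₁P withTranspose t)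
                                                (Fibre.trans (SigF sig TV) (ΣHom-cong sig (λ x → Fibre.refl TV) t) (ΣHom-id sig t)))) ,
        transpose-φ t

    unique : ∀ (h h' : Hom (δ TV) A) →
             IsAlgHom (δVΣ† sig TV) (δ TV) (derivStr sig TV η φ) A a h → IsAlgHom (δVΣ† sig TV) (δ TV) (derivStr sig TV η φ) A a h' →
             ∀ {n} (x : ∣ δ TV ∣ n) → A ⊢ app h x ≈ app h' x
    unique h h' h-alg h'-alg {n} x = begin
      app h x                ≈⟨ Fibre.sym A (app-cong h (act-id TV x)) ⟩
      app h (act TV idS x)   ≈⟨ proj₂ (proj₂ (init P algebraP) _ _ (withTranspose-alg h h-alg) (withTranspose-alg h' h'-alg) x) n idS ⟩
      app h' (act TV idS x)  ≈⟨ app-cong h' (act-id TV x) ⟩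
      app h' x               ∎
      where open ≈-Reasoning (Ob A n)

  derivativeInitial : IsInitial (δVΣ† sig TV) (δ TV) (derivStr sig TV η φ)
  derivativeInitial A a = (fromδTV A a , fromδTV-alg A a) , unique A a

surj-1-onto-2+ : ∀ {n} → Surj 1 (suc n + 1) → ⊥
surj-1-onto-2+ {n} f with surj f (fresh (suc n)) | surj f (zero ↑ˡ 1)
... | zero , p | zero , q = old≢fresh zero (trans (sym q) p)

surj-0-onto-1+ : ∀ {n} → Surj 0 (suc n) → ⊥
surj-0-onto-1+ f with surj f zero
... | () , _

δV-unique : ∀ {n} (f g : ∣ δ V ∣ n) → δ V ⊢ f ≈ g
δV-unique {zero} f g zero with fun f zero | fun g zero
... | zero | zero = refl
δV-unique {suc n} f g = ⊥-elim (surj-1-onto-2+ f)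

δV≅J : Iso (δ V) J
δV≅J = record
  { to = record { app = toJ ; app-cong = λ _ () ; app-nat = λ _ _ () }
  ; from = record
      { app = fromJ
      ; app-cong = λ {_} {f} {g} _ → δV-unique (fromJ f) (fromJ g)
      ; app-nat = λ h f → δV-unique (fromJ (h ∘S f)) (act (δ V) h (fromJ f)) }
  ; from∘to = λ f → δV-unique (fromJ (toJ f)) f
  ; to∘from = λ _ () }
  where
  toJ : ∀ {n} → ∣ δ V ∣ n → ∣ J ∣ n
  toJ {zero} f = idS
  toJ {suc n} f = ⊥-elim (surj-1-onto-2+ f)
  fromJ : ∀ {n} → ∣ J ∣ n → ∣ δ V ∣ n
  fromJ {zero} f = idS
  fromJ {suc n} f = ⊥-elim (surj-0-onto-1+ f)

mainTheorem7 : (sig : Signature) (TV : Presheaf) (η : Hom V TV) (φ : Hom (SigF sig TV) TV) →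
    IsInitial (VΣ sig) TV (algStr sig TV η φ) →
    IsInitial (δVΣ† sig TV) (δ TV) (derivStr sig TV η φ) × Iso (δ V) J
mainTheorem7 sig TV η φ init = Derivative.derivativeInitial sig TV η φ init , δV≅J
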